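{- Let $n\ge1$ and $\varepsilon:[n]\to\{+,-\}$. Then the framing lattice $\mathscr L_{G_\varepsilon,F_\varepsilon}$ is isomorphic to the $\varepsilon$-Cambrian lattice.
   Context: A flow graph $G$ is a finite directed acyclic multigraph with linearly ordered vertices, edges directed from smaller to larger vertices, a unique source $s$ and unique sink $t$; a route is a directed $s$–$t$ path. A framing $F$ gives at each vertex $v$ linear orders $\le_{\mathrm{In}(v)}$, $\le_{\mathrm{Out}(v)}$ on entering and leaving edges. For a path $P$ through $v$, $Pv$ (resp. $vP$) is the maximal subpath of $P$ ending (resp. starting) at $v$. For $Pv,Qv$, let $w$ be the first vertex after which they coincide; if $w$ is the first vertex of one of them they are equal, else $Pv<_{\mathscr I(v)}Qv$ iff $P$'s edge entering $w$ precedes $Q$'s in $\le_{\mathrm{In}(w)}$. Dually for $vP,vQ$ with $w'$ the last vertex before which they coincide, using $\le_{\mathrm{Out}(w')}$, giving $<_{\mathscr O(v)}$. For paths $P,Q$ with common inner vertex $v$, $P<_v^{cw}Q$ means $Pv<_{\mathscr I(v)}Qv$ and $vQ<_{\mathscr O(v)}vP$; they are incoherent at $v$ if $P<_v^{cw}Q$ or $Q<_v^{cw}P$, coherent if incoherent at no common inner vertex. A clique is a set of pairwise coherent routes. For maximal cliques, $C\lessdot C'$ if $C'=(C\setminus\{R\})\cup\{R'\}$ with $R<_u^{cw}R'$ for some $u$; the framing lattice $\mathscr L_{G,F}$ is the set of maximal cliques with the reflexive-transitive closure of $\lessdot$. The Cambrian caracol graph $G_\varepsilon$ has vertices $s<0<1<\dots<n<t$,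 drawn in this order on a horizontal line, with horizontal edges $(s,0),(0,1),\dots,(n-1,n),(n,t)$ drawn on the line, and for each $a\in[n]$ two edges $(s,a)$ and $(a-1,t)$ drawn as arcs above the line if $\varepsilon(a)=+$ and below the line if $\varepsilon(a)=-$ (arcs on the same side nested without crossing). $F_\varepsilon$ is the framing induced by the drawing: at every vertex the incoming edges, and separately the outgoing edges, are ordered from top to bottom. Explicitly, at vertex $a\in[n]$: $(s,a)<_{\mathrm{In}(a)}(a-1,a)$ if $\varepsilon(a)=+$ and $(a-1,a)<_{\mathrm{In}(a)}(s,a)$ if $\varepsilon(a)=-$; at vertex $a-1$: $(a-1,t)<_{\mathrm{Out}(a-1)}(a-1,a)$ if $\varepsilon(a)=+$ and the reverse if $\varepsilon(a)=-$; at $s$ the outgoing edges are ordered: arcs above with endpoints decreasing, then $(s,0)$, then arcs below with endpoints increasing; at $t$ the incoming edges are ordered: arcs above with starting points increasing, then $(n,t)$, then arcs below with starting points decreasing. Let $P_\varepsilon(n)$ be a convex $(n+2)$-gon with vertices $0,1,\dots,n+1$ having strictly increasing $x$-coordinates, with $0$ and $n+1$ on a horizontal line and vertex $i\in[n]$ above this line if $\varepsilon(i)=+$ and below it if $\varepsilon(i)=-$. The $\varepsilon$-Cambrian lattice is the poset on triangulations of $P_\varepsilon(n)$ whose cover relations are increasing-slope diagonal flips (replacing a diagonal by the other diagonal of the quadrilateral formed by its two adjacent triangles, when the new diagonal has larger slope).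
   Formalization: The vertices of the polygon $P_\varepsilon(n)$ have rational coordinates. -}

module Defs where

open import Level using (Level; _⊔_) renaming (suc to lsuc; zero to lzero)
open import Data.Nat as ℕ using (ℕ; zero; suc; _+_; _∸_)
open import Data.Fin as Fin using (Fin; zero; suc; inject₁; fromℕ; toℕ)
import Data.Fin.Properties as FinP
open import Data.List using (List; []; _∷_; reverse)
open import Data.List.Membership.Propositional using (_∈_)
open import Data.Product using (Σ; Σ-syntax; ∃; ∃-syntax; _×_; _,_)
open import Data.Sum using (_⊎_)
open import Data.Empty using (⊥)
open import Data.Unit using (⊤)
open import Data.Bool using (if_then_else_)
open import Relation.Nullary using (¬_; does)
open import Relation.Binary using (Rel; DecidableEquality)
open import Relation.Binary.Bundles.Raw using (RawRelation)
open import Relation.Binary.Morphism.Structures using (IsOrderIsomorphism)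
open import Relation.Binary.PropositionalEquality using (_≡_)
open import Function.Bundles using (_⇔_)
open import Data.Rational as ℚ using (ℚ; 0ℚ)

data RTClosure {a ℓ₁ ℓ₂ : Level} {A : Set a}
               (_≈_ : Rel A ℓ₁) (_⋖_ : Rel A ℓ₂) : Rel A (a ⊔ ℓ₁ ⊔ ℓ₂) where
  base : ∀ {x y} → x ≈ y → RTClosure _≈_ _⋖_ x y
  step : ∀ {x y z} → x ⋖ y → RTClosure _≈_ _⋖_ y z → RTClosure _≈_ _⋖_ x z

OrderIsomorphic : {c ℓ₁ ℓ₂ c' ℓ₁' ℓ₂' : Level} →
  RawRelation c ℓ₁ ℓ₂ → RawRelation c' ℓ₁' ℓ₂' → Set _
OrderIsomorphic P Q =
  Σ[ f ∈ (RawRelation.Carrier P → RawRelation.Carrier Q) ]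
    IsOrderIsomorphism (RawRelation._≈_ P) (RawRelation._≈_ Q)
                       (RawRelation._∼_ P) (RawRelation._∼_ Q) f

-- A framing is given, at every vertex, by linear
-- orders on entering / leaving edges; we encode them by ranks:
-- e ≤_In(tgt e) f  iff  inRank e ≤ inRank f  (for edges with the same
-- target), and similarly outRank for edges with the same source.

record FramedGraph : Set₁ where
  field
    Vertex  : Set
    Edge    : Set
    _≟V_    : DecidableEquality Vertex
    src tgt : Edge → Vertex
    source sink : Vertex
    inRank  : Edge → ℕ
    outRank : Edge → ℕ

module FramingLatticeDef (G : FramedGraph) where
  open FramedGraph G

  Path = List Edge

  Connected : Path → Set
  Connected []           = ⊤
  Connected (e ∷ [])     = ⊤
  Connected (e ∷ f ∷ es) = tgt e ≡ src f × Connected (f ∷ es)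

  StartsAt : Vertex → Path → Set
  StartsAt v []      = ⊥
  StartsAt v (e ∷ _) = src e ≡ v

  EndsAt : Vertex → Path → Set
  EndsAt v []           = ⊥
  EndsAt v (e ∷ [])     = tgt e ≡ v
  EndsAt v (e ∷ f ∷ es) = EndsAt v (f ∷ es)

  IsRoute : Path → Set
  IsRoute P = StartsAt source P × EndsAt sink P × Connected P

  Inner : Vertex → Path → Set
  Inner v P = (∃[ e ] (e ∈ P × tgt e ≡ v)) × (∃[ f ] (f ∈ P × src f ≡ v))

  _upTo_ : Path → Vertex → Path
  []       upTo v = []
  (e ∷ es) upTo v = e ∷ (if does (tgt e ≟V v) then [] else (es upTo v))

  _from_ : Path → Vertex → Path
  []       from v = []
  (e ∷ es) from v = if does (src e ≟V v) then e ∷ es else (es from v)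

  -- If one list is exhausted, they are "equal".
  Lex : (Edge → ℕ) → Path → Path → Set
  Lex r []       _        = ⊥
  Lex r (_ ∷ _)  []       = ⊥
  Lex r (e ∷ es) (f ∷ fs) = (e ≡ f × Lex r es fs) ⊎ (¬ e ≡ f × r e ℕ.< r f)

  -- Pv <_I(v) Qv  (compare from v backwards: common suffix, then In(w))
  _<I[_]_ : Path → Vertex → Path → Set
  P <I[ v ] Q = Lex inRank (reverse (P upTo v)) (reverse (Q upTo v))

  _<O[_]_ : Path → Vertex → Path → Set
  P <O[ v ] Q = Lex outRank (P from v) (Q from v)

  _<cw[_]_ : Path → Vertex → Path → Set
  P <cw[ v ] Q = Inner v P × Inner v Q × (P <I[ v ] Q) × (Q <O[ v ] P)

  IncoherentAt : Vertex → Path → Path → Set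
  IncoherentAt v P Q = (P <cw[ v ] Q) ⊎ (Q <cw[ v ] P)

  Coherent : Path → Path → Set
  Coherent P Q = ∀ v → Inner v P → Inner v Q → ¬ IncoherentAt v P Q

  RouteSet = Path → Set

  IsClique : RouteSet → Set
  IsClique C = (∀ P → C P → IsRoute P) × (∀ P Q → C P → C Q → Coherent P Q)

  IsMaximalClique : RouteSet → Set
  IsMaximalClique C =
    IsClique C × (∀ R → IsRoute R → (∀ P → C P → Coherent R P) → C R)

  MaxClique = Σ RouteSet IsMaximalClique

  _≐_ : Rel MaxClique lzero
  (C , _) ≐ (D , _) = ∀ P → (C P → D P) × (D P → C P)

  _⋖_ : Rel MaxClique lzero
  (C , _) ⋖ (C' , _) =
    Σ[ R ∈ Path ] Σ[ R' ∈ Path ] Σ[ u ∈ Vertex ]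
      C R × (R <cw[ u ] R') ×
      (∀ X → C' X ⇔ ((C X × ¬ X ≡ R) ⊎ X ≡ R'))

  _≤_ : Rel MaxClique (lsuc lzero)
  _≤_ = RTClosure _≐_ _⋖_

  framingLattice : RawRelation (lsuc lzero) lzero (lsuc lzero)
  framingLattice = record { Carrier = MaxClique ; _≈_ = _≐_ ; _∼_ = _≤_ }

data Sign : Set where
  plus minus : Sign

-- vertices s < 0 < 1 < ... < n < t ; inner vertex i ∈ {0..n} is  v i
data CVertex (n : ℕ) : Set where
  s : CVertex n
  v : Fin (suc n) → CVertex n
  t : CVertex n

_≟CV_ : {n : ℕ} → DecidableEquality (CVertex n)
s   ≟CV s   = Relation.Nullary.yes _≡_.refl
s   ≟CV v _ = Relation.Nullary.no λ ()
s   ≟CV t   = Relation.Nullary.no λ ()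
v _ ≟CV s   = Relation.Nullary.no λ ()
v i ≟CV v j with i Fin.≟ j
... | Relation.Nullary.yes _≡_.refl = Relation.Nullary.yes _≡_.refl
... | Relation.Nullary.no i≢j = Relation.Nullary.no λ { _≡_.refl → i≢j _≡_.refl }
v _ ≟CV t   = Relation.Nullary.no λ ()
t   ≟CV s   = Relation.Nullary.no λ ()
t   ≟CV v _ = Relation.Nullary.no λ ()
t   ≟CV t   = Relation.Nullary.yes _≡_.refl

-- edges; for k : Fin n we write a = toℕ k + 1 ∈ [n]
data CEdge (n : ℕ) : Set where
  s0   : CEdge n            -- (s, 0)
  hor  : Fin n → CEdge n    -- (a-1, a)
  nt   : CEdge n            -- (n, t)
  sArc : Fin n → CEdge n    -- (s, a)
  tArc : Fin n → CEdge n    -- (a-1, t)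

module _ (n : ℕ) (ε : Fin n → Sign) where

  csrc : CEdge n → CVertex n
  csrc s0       = s
  csrc (hor k)  = v (inject₁ k)
  csrc nt       = v (fromℕ n)
  csrc (sArc k) = s
  csrc (tArc k) = v (inject₁ k)

  ctgt : CEdge n → CVertex n
  ctgt s0       = v zero
  ctgt (hor k)  = v (suc k)
  ctgt nt       = t
  ctgt (sArc k) = v (suc k)
  ctgt (tArc k) = t

  -- F_ε, incoming orders (top to bottom):
  --  at a ∈ [n]: (s,a) < (a-1,a) if ε(a)=+, reverse if ε(a)=-;
  --  at t: arcs above with start points increasing, then (n,t), then
  --        arcs below with start points decreasing.
  cinRank : CEdge n → ℕ
  cinRank s0       = 0
  cinRank (hor k)  with ε k
  ... | plus  = 1
  ... | minus = 0
  cinRank nt       = n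
  cinRank (sArc k) with ε k
  ... | plus  = 0
  ... | minus = 1
  cinRank (tArc k) with ε k
  ... | plus  = toℕ k
  ... | minus = n + (n ∸ toℕ k)

  -- F_ε, outgoing orders (top to bottom):
  --  at a-1 (a ∈ [n]): (a-1,t) < (a-1,a) if ε(a)=+, reverse if ε(a)=-;
  --  at s: arcs above with endpoints decreasing, then (s,0), then arcs
  --        below with endpoints increasing.
  coutRank : CEdge n → ℕ
  coutRank s0       = n
  coutRank (hor k)  with ε k
  ... | plus  = 1
  ... | minus = 0
  coutRank nt       = 0
  coutRank (sArc k) with ε k
  ... | plus  = n ∸ suc (toℕ k)
  ... | minus = n + suc (toℕ k)
  coutRank (tArc k) with ε k
  ... | plus  = 0
  ... | minus = 1

  caracol : FramedGraph
  caracol = record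
    { Vertex = CVertex n ; Edge = CEdge n ; _≟V_ = _≟CV_
    ; src = csrc ; tgt = ctgt ; source = s ; sink = t
    ; inRank = cinRank ; outRank = coutRank }

module _ (n : ℕ) (ε : Fin n → Sign) (x y : Fin (2 + n) → ℚ) where

  -- vertex i ∈ [n] of the polygon, for k : Fin n with i = toℕ k + 1
  innerPt : Fin n → Fin (2 + n)
  innerPt k = suc (inject₁ k)

  lastPt : Fin (2 + n)
  lastPt = fromℕ (suc n)

  -- orientation determinant of (p_i, p_j, p_k): positive iff p_k lies
  -- strictly to the left of the directed line p_i → p_j
  orient : Fin (2 + n) → Fin (2 + n) → Fin (2 + n) → ℚ
  orient i j k = ((x j ℚ.- x i) ℚ.* (y k ℚ.- y i)) ℚ.- ((y j ℚ.- y i) ℚ.* (x k ℚ.- x i))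

  record IsCambrianPolygon : Set where
    field
      x-increasing : ∀ i j → i Fin.< j → x i ℚ.< x j
      horizontal   : y zero ≡ y lastPt
      above        : ∀ k → ε k ≡ plus  → y zero ℚ.< y (innerPt k)
      below        : ∀ k → ε k ≡ minus → y (innerPt k) ℚ.< y zero
      convex-above : ∀ k i j → ε k ≡ plus → i Fin.< innerPt k → innerPt k Fin.< j →
                       0ℚ ℚ.< orient i j (innerPt k)
      convex-below : ∀ k i j → ε k ≡ minus → i Fin.< innerPt k → innerPt k Fin.< j →
                       orient i j (innerPt k) ℚ.< 0ℚ

  Cross : Fin (2 + n) → Fin (2 + n) → Fin (2 + n) → Fin (2 + n) → Set
  Cross i j k l =
    ¬ i ≡ k × ¬ i ≡ l × ¬ j ≡ k × ¬ j ≡ l ×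
    (orient i j k ℚ.* orient i j l) ℚ.< 0ℚ ×
    (orient k l i ℚ.* orient k l j) ℚ.< 0ℚ

  -- slope(p_i p_j) < slope(p_k p_l), for i < j, k < l (so the
  -- x-differences are positive and we may cross-multiply)
  SlopeLess : Fin (2 + n) → Fin (2 + n) → Fin (2 + n) → Fin (2 + n) → Set
  SlopeLess i j k l =
    ((y j ℚ.- y i) ℚ.* (x l ℚ.- x k)) ℚ.< ((y l ℚ.- y k) ℚ.* (x j ℚ.- x i))

  SegSet = Fin (2 + n) → Fin (2 + n) → Set

  IsTriangulation : SegSet → Set
  IsTriangulation T =
    (∀ i j → T i j → i Fin.< j) ×
    (∀ i j k l → T i j → T k l → ¬ Cross i j k l) ×
    (∀ i j → i Fin.< j → (∀ k l → T k l → ¬ Cross i j k l) → T i j)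

  Triangulation = Σ SegSet IsTriangulation

  _≐T_ : Rel Triangulation lzero
  (T , _) ≐T (T' , _) = ∀ i j → (T i j → T' i j) × (T' i j → T i j)

  _⋖T_ : Rel Triangulation lzero
  (T , _) ⋖T (T' , _) =
    Σ[ i ∈ Fin (2 + n) ] Σ[ j ∈ Fin (2 + n) ] Σ[ k ∈ Fin (2 + n) ] Σ[ l ∈ Fin (2 + n) ]
      T i j × k Fin.< l × SlopeLess i j k l ×
      (∀ a b → T' a b ⇔ ((T a b × ¬ (a ≡ i × b ≡ j)) ⊎ (a ≡ k × b ≡ l)))

  _≤T_ : Rel Triangulation (lsuc lzero)
  _≤T_ = RTClosure _≐T_ _⋖T_

  cambrianLattice : RawRelation (lsuc lzero) lzero (lsuc lzero)
  cambrianLattice = record { Carrier = Triangulation ; _≈_ = _≐T_ ; _∼_ = _≤T_ }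

framingLatticeOf : FramedGraph → RawRelation (lsuc lzero) lzero (lsuc lzero)
framingLatticeOf G = FramingLatticeDef.framingLattice G

-- A route of G_ε enters the horizontal line at some vertex a (by (s,0) or by the arc (s,a)),
-- runs along it to some b ≥ a and leaves it by the arc (b,t) or by (n,t); it corresponds to the
-- segment [p_a, p_(b+1)] of P_ε(n).  Two routes a..b and c..d meet exactly at the vertices
-- between max(a,c) and min(b,d); there their incoming order is decided at max(a,c), where one
-- of them arrives by its arc and the other along the line, and their outgoing order at
-- min(b,d).  With F_ε both comparisons are read off the signs of ε at a, c, resp. b+1, d+1, so
-- incoherence is a condition on the endpoints and ε.  On the polygon side, convexity says that
-- the orientation of p_a, p_c, p_b for a < b < c has the sign ε(b); this turns "the segments cross,
-- the second one being steeper" into the very same condition.  Hence maximal cliques are the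
-- triangulations, and exchanging R for R′ with R <cw R′ is an increasing-slope flip.

module Submission where

open import Defs
open import Data.Nat using (ℕ; _≤_; _+_)
open import Data.Fin using (Fin)
open import Data.Rational using (ℚ)

open import Level using (Level; 0ℓ)
open import Data.Nat as N using (zero; suc; pred; z≤n; s≤s; _∸_)
import Data.Nat.Properties as NP
open import Data.Fin as F using (toℕ; inject₁; fromℕ)
import Data.Fin.Properties as FP
open import Data.Rational as Q using (0ℚ)
import Data.Rational.Properties as QP
open import Data.Rational.Solver using (module +-*-Solver)
open import Data.List using (List; []; _∷_; _++_; reverse; [_])
import Data.List.Properties as LP
open import Data.List.Membership.Propositional using (_∈_)
open import Data.List.Relation.Unary.Any using (here; there)
open import Data.List.Membership.Propositional.Properties using (∈-++⁺ˡ; ∈-++⁺ʳ; ∈-++⁻)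
open import Data.Product as Product using (∃-syntax; _×_; _,_; proj₁; proj₂)
open import Data.Sum as Sum using (_⊎_; inj₁; inj₂; [_,_]′)
open import Data.Empty using (⊥-elim)
open import Data.Unit using (tt)
open import Relation.Nullary using (¬_; yes; no; Dec; ¬?)
open import Relation.Nullary.Decidable using (dec-true; dec-false; decidable-stable; _×-dec_)
open import Relation.Binary using (Rel; IsEquivalence; tri<; tri≈; tri>)
open import Relation.Binary.Core using (_Preserves_⟶_)
open import Relation.Binary.Definitions using (_Respectsˡ_)
open import Relation.Binary.Morphism.Structures using (IsOrderIsomorphism)
open import Relation.Binary.PropositionalEquality hiding ([_])
open import Function using (_∘_; id)
open import Function.Bundles using (_⇔_; mk⇔; Equivalence)

clamp : ∀ {N} → ℕ → Fin (suc N)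
clamp {zero}  _       = F.zero
clamp {suc N} zero    = F.zero
clamp {suc N} (suc k) = F.suc (clamp k)

toℕ-clamp : ∀ {N} k → k N.≤ N → toℕ (clamp {N} k) ≡ k
toℕ-clamp {zero}  zero    _       = refl
toℕ-clamp {suc N} zero    _       = refl
toℕ-clamp {suc N} (suc k) (s≤s p) = cong suc (toℕ-clamp k p)

clamp-toℕ : ∀ {N} (i : Fin (suc N)) → clamp (toℕ i) ≡ i
clamp-toℕ {zero}  F.zero    = refl
clamp-toℕ {suc N} F.zero    = refl
clamp-toℕ {suc N} (F.suc i) = cong F.suc (clamp-toℕ i)

inject₁-clamp : ∀ {N} k → k N.≤ N → inject₁ (clamp {N} k) ≡ clamp k
inject₁-clamp {zero}  zero    _       = refl
inject₁-clamp {suc N} zero    _       = refl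
inject₁-clamp {suc N} (suc k) (s≤s p) = cong F.suc (inject₁-clamp k p)

fromℕ≡clamp : ∀ N → fromℕ N ≡ clamp {N} N
fromℕ≡clamp zero    = refl
fromℕ≡clamp (suc N) = cong F.suc (fromℕ≡clamp N)

reverse-++-∷ : ∀ {a} {A : Set a} (xs : List A) z ys →
               reverse (xs ++ z ∷ ys) ≡ reverse ys ++ z ∷ reverse xs
reverse-++-∷ xs z ys = begin
  reverse (xs ++ z ∷ ys)               ≡⟨ LP.reverse-++ xs (z ∷ ys) ⟩
  reverse (z ∷ ys) ++ reverse xs       ≡⟨ cong (_++ reverse xs) (LP.unfold-reverse z ys) ⟩
  (reverse ys ++ [ z ]) ++ reverse xs  ≡⟨ LP.++-assoc (reverse ys) [ z ] (reverse xs) ⟩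
  reverse ys ++ z ∷ reverse xs         ∎
  where open ≡-Reasoning

module _ {a ℓ₁ ℓ₂ : Level} {A : Set a} {_≈_ : Rel A ℓ₁} {_⋖_ : Rel A ℓ₂}
         (≈-isEquivalence : IsEquivalence _≈_) (⋖-respˡ-≈ : _⋖_ Respectsˡ _≈_) where

  module ≈ = IsEquivalence ≈-isEquivalence

  RTClosure-resp-≈ : ∀ {x x′ y′ y} → x ≈ x′ → y′ ≈ y →
                     RTClosure _≈_ _⋖_ x′ y′ → RTClosure _≈_ _⋖_ x y
  RTClosure-resp-≈ x≈x′ y′≈y (base x′≈y′)  = base (≈.trans x≈x′ (≈.trans x′≈y′ y′≈y))
  RTClosure-resp-≈ x≈x′ y′≈y (step x′⋖z r) =
    step (⋖-respˡ-≈ (≈.sym x≈x′) x′⋖z) (RTClosure-resp-≈ ≈.refl y′≈y r)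

module _ {a b ℓ₁ ℓ₂ ℓ₃ ℓ₄ : Level} {A : Set a} {B : Set b}
         {_≈₁_ : Rel A ℓ₁} {_⋖₁_ : Rel A ℓ₂} {_≈₂_ : Rel B ℓ₃} {_⋖₂_ : Rel B ℓ₄} where

  RTClosure-map : (f : A → B) → f Preserves _≈₁_ ⟶ _≈₂_ → f Preserves _⋖₁_ ⟶ _⋖₂_ →
                  f Preserves RTClosure _≈₁_ _⋖₁_ ⟶ RTClosure _≈₂_ _⋖₂_
  RTClosure-map f f-cong f-step (base x≈y)   = base (f-cong x≈y)
  RTClosure-map f f-cong f-step (step x⋖z r) = step (f-step x⋖z) (RTClosure-map f f-cong f-step r)

module _ {a b ℓ₁ ℓ₂ ℓ₃ ℓ₄ : Level} {A : Set a} {B : Set b}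
         {_≈₁_ : Rel A ℓ₁} {_⋖₁_ : Rel A ℓ₂} {_≈₂_ : Rel B ℓ₃} {_⋖₂_ : Rel B ℓ₄} where

  inverse⇒isOrderIsomorphism :
    IsEquivalence _≈₁_ → IsEquivalence _≈₂_ → _⋖₁_ Respectsˡ _≈₁_ →
    (f : A → B) (g : B → A) →
    f Preserves _≈₁_ ⟶ _≈₂_ → g Preserves _≈₂_ ⟶ _≈₁_ →
    f Preserves _⋖₁_ ⟶ _⋖₂_ → g Preserves _⋖₂_ ⟶ _⋖₁_ →
    (∀ x → x ≈₁ g (f x)) → (∀ y → f (g y) ≈₂ y) →
    IsOrderIsomorphism _≈₁_ _≈₂_ (RTClosure _≈₁_ _⋖₁_) (RTClosure _≈₂_ _⋖₂_) f
  inverse⇒isOrderIsomorphism ≈₁-equiv ≈₂-equiv ⋖₁-resp f g f-cong g-cong f-step g-step gf fg = record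
    { isOrderMonomorphism = record
      { isOrderHomomorphism = record
        { cong = f-cong
        ; mono = RTClosure-map f f-cong f-step }
      ; injective = λ {x} {y} fx≈fy → ≈₁.trans (gf x) (≈₁.trans (g-cong fx≈fy) (≈₁.sym (gf y)))
      ; cancel = λ {x} {y} fx≤fy →
          RTClosure-resp-≈ ≈₁-equiv ⋖₁-resp (gf x) (≈₁.sym (gf y))
            (RTClosure-map g g-cong g-step fx≤fy) }
    ; surjective = λ y → g y , λ z≈gy → ≈₂.trans (f-cong z≈gy) (fg y) }
    where
    module ≈₁ = IsEquivalence ≈₁-equiv
    module ≈₂ = IsEquivalence ≈₂-equiv

opposite : Sign → Sign
opposite plus  = minus
opposite minus = plus

opposite-involutive : ∀ s → opposite (opposite s) ≡ s
opposite-involutive plus  = refl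
opposite-involutive minus = refl

opposite-injective : ∀ {s s′} → opposite s ≡ opposite s′ → s ≡ s′
opposite-injective {plus}  {plus}  _ = refl
opposite-injective {minus} {minus} _ = refl

sign-cases : ∀ {a} {A : Set a} s → (s ≡ plus → A) → (s ≡ minus → A) → A
sign-cases plus  f g = f refl
sign-cases minus f g = g refl

HasSign : ℚ → Sign → Set
HasSign q plus  = 0ℚ Q.< q
HasSign q minus = q Q.< 0ℚ

neg-HasSign : ∀ q s → HasSign q s → HasSign (Q.- q) (opposite s)
neg-HasSign q plus  p = QP.neg-antimono-< p
neg-HasSign q minus p = QP.neg-antimono-< p

*-sameSign⇒≮0 : ∀ a b s → HasSign a s → HasSign b s → ¬ (a Q.* b Q.< 0ℚ)
*-sameSign⇒≮0 a b plus  pa pb lt =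
  QP.<-asym lt (QP.positive⁻¹ _ {{QP.pos*pos⇒pos a {{Q.positive pa}} b {{Q.positive pb}}}})
*-sameSign⇒≮0 a b minus pa pb lt =
  QP.<-asym lt (QP.positive⁻¹ _ {{QP.neg*neg⇒pos a {{Q.negative pa}} b {{Q.negative pb}}}})

*-oppositeSign⇒<0 : ∀ a b s → HasSign a s → HasSign b (opposite s) → a Q.* b Q.< 0ℚ
*-oppositeSign⇒<0 a b plus  pa pb = QP.negative⁻¹ _ {{QP.pos*neg⇒neg a {{Q.positive pa}} b {{Q.negative pb}}}}
*-oppositeSign⇒<0 a b minus pa pb = QP.negative⁻¹ _ {{QP.neg*pos⇒neg a {{Q.negative pa}} b {{Q.positive pb}}}}

*-<0⇒oppositeSign : ∀ a b s s′ → HasSign a s → HasSign b s′ → a Q.* b Q.< 0ℚ → s′ ≡ opposite s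
*-<0⇒oppositeSign a b plus  plus  pa pb lt = ⊥-elim (*-sameSign⇒≮0 a b plus pa pb lt)
*-<0⇒oppositeSign a b plus  minus pa pb lt = refl
*-<0⇒oppositeSign a b minus plus  pa pb lt = refl
*-<0⇒oppositeSign a b minus minus pa pb lt = ⊥-elim (*-sameSign⇒≮0 a b minus pa pb lt)

HasSign-difference : ∀ a b s → HasSign a (opposite s) → HasSign b s → HasSign (b Q.- a) s
HasSign-difference a b plus a<0 0<b =
  QP.positive⁻¹ _ {{QP.pos+pos⇒pos b {{Q.positive 0<b}} (Q.- a) {{Q.positive (QP.neg-antimono-< a<0)}}}}
HasSign-difference a b minus 0<a b<0 =
  QP.negative⁻¹ _ {{QP.neg+neg⇒neg b {{Q.negative b<0}} (Q.- a) {{Q.negative (QP.neg-antimono-< 0<a)}}}}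

c<c+d : ∀ c d → 0ℚ Q.< d → c Q.< c Q.+ d
c<c+d c d 0<d = subst (Q._< c Q.+ d) (QP.+-identityʳ c) (QP.+-monoʳ-< c 0<d)

c+d<c : ∀ c d → d Q.< 0ℚ → c Q.+ d Q.< c
c+d<c c d d<0 = subst (c Q.+ d Q.<_) (QP.+-identityʳ c) (QP.+-monoʳ-< c d<0)

-- Defs.orient on explicit coordinates, so that the ring solver applies.
module OrientationAlgebra where
  open +-*-Solver

  det : ℚ → ℚ → ℚ → ℚ → ℚ → ℚ → ℚ
  det xi yi xj yj xk yk = ((xj Q.- xi) Q.* (yk Q.- yi)) Q.- ((yj Q.- yi) Q.* (xk Q.- xi))

  det-swap : ∀ a b c d e f → det a b c d e f ≡ Q.- det a b e f c d
  det-swap = solve 6 (λ a b c d e f →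
    ((c :- a) :* (f :- b)) :- ((d :- b) :* (e :- a)) :=
    :- (((e :- a) :* (d :- b)) :- ((f :- b) :* (c :- a)))) refl

  det-rotate : ∀ a b c d e f → det a b c d e f ≡ det c d e f a b
  det-rotate = solve 6 (λ a b c d e f →
    ((c :- a) :* (f :- b)) :- ((d :- b) :* (e :- a)) :=
    ((e :- c) :* (b :- d)) :- ((f :- d) :* (a :- c))) refl

  -- Comparing the slopes of [p_i,p_j] and [p_k,p_l] amounts to comparing the
  -- orientations of p_k and p_l with respect to the line p_i p_j.
  det-slope : ∀ a b c d e f g h →
    (h Q.- f) Q.* (c Q.- a) ≡ ((d Q.- b) Q.* (g Q.- e)) Q.+ (det a b c d g h Q.- det a b c d e f)
  det-slope = solve 8 (λ a b c d e f g h →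
    (h :- f) :* (c :- a) :=
    ((d :- b) :* (g :- e)) :+ ((((c :- a) :* (h :- b)) :- ((d :- b) :* (g :- a))) :-
                               (((c :- a) :* (f :- b)) :- ((d :- b) :* (e :- a))))) refl

module PathLemmas (G : FramedGraph) where
  open FramedGraph G
  open FramingLatticeDef G

  Lex-irrefl : ∀ r P → ¬ Lex r P P
  Lex-irrefl r []      ()
  Lex-irrefl r (e ∷ P) (inj₁ (_ , l))   = Lex-irrefl r P l
  Lex-irrefl r (e ∷ P) (inj₂ (e≢e , _)) = e≢e refl

  Lex-fork⁻ : ∀ r xs e f ys zs → ¬ e ≡ f → Lex r (xs ++ e ∷ ys) (xs ++ f ∷ zs) → r e N.< r f
  Lex-fork⁻ r []       e f ys zs e≢f (inj₁ (e≡f , _)) = ⊥-elim (e≢f e≡f)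
  Lex-fork⁻ r []       e f ys zs e≢f (inj₂ (_ , lt))  = lt
  Lex-fork⁻ r (_ ∷ xs) e f ys zs e≢f (inj₁ (_ , l))   = Lex-fork⁻ r xs e f ys zs e≢f l
  Lex-fork⁻ r (_ ∷ xs) e f ys zs e≢f (inj₂ (x≢x , _)) = ⊥-elim (x≢x refl)

  Lex-fork⁺ : ∀ r xs e f ys zs → ¬ e ≡ f → r e N.< r f → Lex r (xs ++ e ∷ ys) (xs ++ f ∷ zs)
  Lex-fork⁺ r []       e f ys zs e≢f lt = inj₂ (e≢f , lt)
  Lex-fork⁺ r (_ ∷ xs) e f ys zs e≢f lt = inj₁ (refl , Lex-fork⁺ r xs e f ys zs e≢f lt)

  upTo-++-∷ : ∀ xs e ys w → (∀ x → x ∈ xs → ¬ tgt x ≡ w) → tgt e ≡ w →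
              (xs ++ e ∷ ys) upTo w ≡ xs ++ [ e ]
  upTo-++-∷ []       e ys w _ te rewrite dec-true (tgt e ≟V w) te = refl
  upTo-++-∷ (x ∷ xs) e ys w ∉w te rewrite dec-false (tgt x ≟V w) (∉w x (here refl)) =
    cong (x ∷_) (upTo-++-∷ xs e ys w (λ z z∈xs → ∉w z (there z∈xs)) te)

  from-++ : ∀ xs ys w → (∀ x → x ∈ xs → ¬ src x ≡ w) → StartsAt w ys → (xs ++ ys) from w ≡ ys
  from-++ []       (e ∷ ys) w _ se rewrite dec-true (src e ≟V w) se = refl
  from-++ (x ∷ xs) ys       w ∉w se rewrite dec-false (src x ≟V w) (∉w x (here refl)) =
    from-++ xs ys w (λ z z∈xs → ∉w z (there z∈xs)) se

  Connected-∷ : ∀ e P → StartsAt (tgt e) P → Connected P → Connected (e ∷ P)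
  Connected-∷ e (f ∷ P) st c = sym st , c

  EndsAt-∷ʳ : ∀ P e w → tgt e ≡ w → EndsAt w (P ++ [ e ])
  EndsAt-∷ʳ []          e w te = te
  EndsAt-∷ʳ (_ ∷ [])    e w te = te
  EndsAt-∷ʳ (_ ∷ f ∷ P) e w te = EndsAt-∷ʳ (f ∷ P) e w te

module Crossing (m : ℕ) (ε : Fin (suc m) → Sign) where

  -- ε(p) for a vertex p ∈ [n] of the polygon; junk for p ∉ [n]
  signAt : ℕ → Sign
  signAt p = ε (clamp (pred p))

  -- InBefore i k: a route entering the line at i precedes one entering at k in the incoming
  -- order where they meet; OutAfter j l: a route leaving the line at j - 1 follows one leaving
  -- at l - 1 in the outgoing order where they part.
  InBefore : ℕ → ℕ → Set
  InBefore i k = (i N.< k × signAt k ≡ minus) ⊎ (k N.< i × signAt i ≡ plus)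

  OutAfter : ℕ → ℕ → Set
  OutAfter j l = (j N.< l × signAt j ≡ minus) ⊎ (l N.< j × signAt l ≡ plus)

  -- Both "route i (j - 1) <cw route k (l - 1)" and "[p_i,p_j] crosses the steeper [p_k,p_l]"
  -- come down to this condition.
  CwCrossing : ℕ → ℕ → ℕ → ℕ → Set
  CwCrossing i j k l = i N.< l × k N.< j × InBefore i k × OutAfter j l

  InBefore⇒≢ : ∀ {i k} → InBefore i k → i ≢ k
  InBefore⇒≢ (inj₁ (i<k , _)) = NP.<⇒≢ i<k
  InBefore⇒≢ (inj₂ (k<i , _)) = NP.>⇒≢ k<i

  OutAfter⇒≢ : ∀ {j l} → OutAfter j l → j ≢ l
  OutAfter⇒≢ (inj₁ (j<l , _)) = NP.<⇒≢ j<l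
  OutAfter⇒≢ (inj₂ (l<j , _)) = NP.>⇒≢ l<j

module Polygon (m : ℕ) (ε : Fin (suc m) → Sign) (x y : Fin (2 + suc m) → ℚ)
               (polygon : IsCambrianPolygon (suc m) ε x y) where

  open Crossing m ε
  open OrientationAlgebra
  open IsCambrianPolygon polygon

  n : ℕ
  n = suc m

  Pt : Set
  Pt = Fin (2 + n)

  orientation : Pt → Pt → Pt → ℚ
  orientation = orient n ε x y

  orientation-swap : ∀ p q r → orientation p q r ≡ Q.- orientation p r q
  orientation-swap p q r = det-swap (x p) (y p) (x q) (y q) (x r) (y r)

  orientation-rotate : ∀ p q r → orientation p q r ≡ orientation q r p
  orientation-rotate p q r = det-rotate (x p) (y p) (x q) (y q) (x r) (y r)

  innerPt-clamp : ∀ (q : Pt) → 0 N.< toℕ q → toℕ q N.≤ n →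
                  innerPt n ε x y (clamp (pred (toℕ q))) ≡ q
  innerPt-clamp q 0<q q≤n with toℕ q in toℕq≡
  innerPt-clamp q () q≤n | zero
  ... | suc q′ = trans (cong F.suc (inject₁-clamp q′ (NP.≤-pred q≤n)))
                       (trans (cong clamp (sym toℕq≡)) (clamp-toℕ q))

  HasSign-convexity : ∀ k i j → i F.< innerPt n ε x y k → innerPt n ε x y k F.< j →
                      HasSign (orientation i j (innerPt n ε x y k)) (ε k)
  HasSign-convexity k i j i<k k<j with ε k in εk≡
  ... | plus  = convex-above k i j εk≡ i<k k<j
  ... | minus = convex-below k i j εk≡ i<k k<j

  orientation-acb : ∀ a b c → a F.< b → b F.< c → HasSign (orientation a c b) (signAt (toℕ b))
  orientation-acb a b c a<b b<c =
    subst (λ w → HasSign (orientation a c w) (signAt (toℕ b))) k≡b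
      (HasSign-convexity k a c (subst (a F.<_) (sym k≡b) a<b) (subst (F._< c) (sym k≡b) b<c))
    where
    k : Fin n
    k = clamp (pred (toℕ b))
    k≡b : innerPt n ε x y k ≡ b
    k≡b = innerPt-clamp b (NP.≤-<-trans z≤n a<b) (NP.≤-pred (NP.≤-trans b<c (NP.≤-pred (FP.toℕ<n c))))

  orientation-abc : ∀ a b c → a F.< b → b F.< c → HasSign (orientation a b c) (opposite (signAt (toℕ b)))
  orientation-abc a b c a<b b<c = subst (λ q → HasSign q _) (sym (orientation-swap a b c))
                                    (neg-HasSign _ _ (orientation-acb a b c a<b b<c))

  orientation-bca : ∀ a b c → a F.< b → b F.< c → HasSign (orientation b c a) (opposite (signAt (toℕ b)))
  orientation-bca a b c a<b b<c = subst (λ q → HasSign q _) (orientation-rotate a b c)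
                                    (orientation-abc a b c a<b b<c)

  CwCrossing⇒orientationSigns : ∀ i j k l → i F.< j → k F.< l →
    CwCrossing (toℕ i) (toℕ j) (toℕ k) (toℕ l) →
    HasSign (orientation i j k) minus × HasSign (orientation i j l) plus ×
    HasSign (orientation k l i) plus  × HasSign (orientation k l j) minus
  CwCrossing⇒orientationSigns i j k l i<j k<l (i<l , k<j , inj₁ (i<k , k⁻) , inj₁ (j<l , j⁻)) =
    subst (HasSign _) k⁻ (orientation-acb i k j i<k k<j) ,
    subst (HasSign _) (cong opposite j⁻) (orientation-abc i j l i<j j<l) ,
    subst (HasSign _) (cong opposite k⁻) (orientation-bca i k l i<k k<l) ,
    subst (HasSign _) j⁻ (orientation-acb k j l k<j j<l)
  CwCrossing⇒orientationSigns i j k l i<j k<l (i<l , k<j , inj₁ (i<k , k⁻) , inj₂ (l<j , l⁺)) =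
    subst (HasSign _) k⁻ (orientation-acb i k j i<k k<j) ,
    subst (HasSign _) l⁺ (orientation-acb i l j i<l l<j) ,
    subst (HasSign _) (cong opposite k⁻) (orientation-bca i k l i<k k<l) ,
    subst (HasSign _) (cong opposite l⁺) (orientation-abc k l j k<l l<j)
  CwCrossing⇒orientationSigns i j k l i<j k<l (i<l , k<j , inj₂ (k<i , i⁺) , inj₁ (j<l , j⁻)) =
    subst (HasSign _) (cong opposite i⁺) (orientation-bca k i j k<i i<j) ,
    subst (HasSign _) (cong opposite j⁻) (orientation-abc i j l i<j j<l) ,
    subst (HasSign _) i⁺ (orientation-acb k i l k<i i<l) ,
    subst (HasSign _) j⁻ (orientation-acb k j l k<j j<l)
  CwCrossing⇒orientationSigns i j k l i<j k<l (i<l , k<j , inj₂ (k<i , i⁺) , inj₂ (l<j , l⁺)) =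
    subst (HasSign _) (cong opposite i⁺) (orientation-bca k i j k<i i<j) ,
    subst (HasSign _) l⁺ (orientation-acb i l j i<l l<j) ,
    subst (HasSign _) i⁺ (orientation-acb k i l k<i i<l) ,
    subst (HasSign _) (cong opposite l⁺) (orientation-abc k l j k<l l<j)

  CrossP : Pt → Pt → Pt → Pt → Set
  CrossP = Cross n ε x y

  Cross? : ∀ i j k l → Dec (CrossP i j k l)
  Cross? i j k l =
    ¬? (i F.≟ k) ×-dec ¬? (i F.≟ l) ×-dec ¬? (j F.≟ k) ×-dec ¬? (j F.≟ l) ×-dec
    (orientation i j k Q.* orientation i j l QP.<? 0ℚ) ×-dec (orientation k l i Q.* orientation k l j QP.<? 0ℚ)

  Cross-sym : ∀ i j k l → CrossP i j k l → CrossP k l i j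
  Cross-sym i j k l (i≢k , i≢l , j≢k , j≢l , kl-splits-ij , ij-splits-kl) =
    ≢-sym i≢k , ≢-sym j≢k , ≢-sym i≢l , ≢-sym j≢l , ij-splits-kl , kl-splits-ij

  CwCrossing⇒Cross : ∀ i j k l → i F.< j → k F.< l →
                     CwCrossing (toℕ i) (toℕ j) (toℕ k) (toℕ l) → CrossP i j k l
  CwCrossing⇒Cross i j k l i<j k<l c@(i<l , k<j , in< , out>)
    with CwCrossing⇒orientationSigns i j k l i<j k<l c
  ... | ijk⁻ , ijl⁺ , kli⁺ , klj⁻ =
    InBefore⇒≢ in< ∘ cong toℕ , FP.<⇒≢ i<l , ≢-sym (FP.<⇒≢ k<j) , OutAfter⇒≢ out> ∘ cong toℕ ,
    *-oppositeSign⇒<0 _ _ minus ijk⁻ ijl⁺ , *-oppositeSign⇒<0 _ _ plus kli⁺ klj⁻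

  Cross⇒interleaved : ∀ i j k l → i F.< j → k F.< l → CrossP i j k l → i F.< l × k F.< j
  Cross⇒interleaved i j k l i<j k<l (_ , i≢l , j≢k , _ , ij-separates , kl-separates)
    with FP.<-cmp j k | FP.<-cmp l i
  ... | tri< j<k _ _ | _ = ⊥-elim (*-sameSign⇒≮0 _ _ _
          (orientation-bca i k l (NP.<-trans i<j j<k) k<l) (orientation-bca j k l j<k k<l) kl-separates)
  ... | tri≈ _ j≡k _ | _ = ⊥-elim (j≢k j≡k)
  ... | _ | tri< l<i _ _ = ⊥-elim (*-sameSign⇒≮0 _ _ _
          (orientation-bca k i j (NP.<-trans k<l l<i) i<j) (orientation-bca l i j l<i i<j) ij-separates)
  ... | _ | tri≈ _ l≡i _ = ⊥-elim (i≢l (sym l≡i))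
  ... | tri> _ _ k<j | tri> _ _ i<l = i<l , k<j

  Cross⇒CwCrossing : ∀ i j k l → i F.< j → k F.< l → CrossP i j k l →
    CwCrossing (toℕ i) (toℕ j) (toℕ k) (toℕ l) ⊎ CwCrossing (toℕ k) (toℕ l) (toℕ i) (toℕ j)
  Cross⇒CwCrossing i j k l i<j k<l cross@(i≢k , _ , _ , j≢l , ij-separates , _)
    with Cross⇒interleaved i j k l i<j k<l cross | FP.<-cmp i k | FP.<-cmp j l
  ... | _ | tri≈ _ i≡k _ | _ = ⊥-elim (i≢k i≡k)
  ... | _ | _ | tri≈ _ j≡l _ = ⊥-elim (j≢l j≡l)
  ... | i<l , k<j | tri< i<k _ _ | tri< j<l _ _ =
    sign-cases (signAt (toℕ k))
      (λ k⁺ → inj₂ (k<j , i<l , inj₂ (i<k , k⁺) , inj₂ (j<l , trans j≡k k⁺)))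
      (λ k⁻ → inj₁ (i<l , k<j , inj₁ (i<k , k⁻) , inj₁ (j<l , trans j≡k k⁻)))
    where
    j≡k = opposite-injective (*-<0⇒oppositeSign _ _ _ _
            (orientation-acb i k j i<k k<j) (orientation-abc i j l i<j j<l) ij-separates)
  ... | i<l , k<j | tri< i<k _ _ | tri> _ _ l<j =
    sign-cases (signAt (toℕ k))
      (λ k⁺ → inj₂ (k<j , i<l , inj₂ (i<k , k⁺) , inj₁ (l<j , trans l≡k̄ (cong opposite k⁺))))
      (λ k⁻ → inj₁ (i<l , k<j , inj₁ (i<k , k⁻) , inj₂ (l<j , trans l≡k̄ (cong opposite k⁻))))
    where
    l≡k̄ = *-<0⇒oppositeSign _ _ _ _ (orientation-acb i k j i<k k<j) (orientation-acb i l j i<l l<j) ij-separates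
  ... | i<l , k<j | tri> _ _ k<i | tri< j<l _ _ =
    sign-cases (signAt (toℕ i))
      (λ i⁺ → inj₁ (i<l , k<j , inj₂ (k<i , i⁺) , inj₁ (j<l , trans j≡ī (cong opposite i⁺))))
      (λ i⁻ → inj₂ (k<j , i<l , inj₁ (k<i , i⁻) , inj₂ (j<l , trans j≡ī (cong opposite i⁻))))
    where
    j≡ī = opposite-injective (*-<0⇒oppositeSign _ _ _ _
            (orientation-bca k i j k<i i<j) (orientation-abc i j l i<j j<l) ij-separates)
  ... | i<l , k<j | tri> _ _ k<i | tri> _ _ l<j =
    sign-cases (signAt (toℕ i))
      (λ i⁺ → inj₁ (i<l , k<j , inj₂ (k<i , i⁺) , inj₂ (l<j , trans l≡i i⁺)))
      (λ i⁻ → inj₂ (k<j , i<l , inj₁ (k<i , i⁻) , inj₁ (l<j , trans l≡i i⁻)))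
    where
    l≡i = trans (*-<0⇒oppositeSign _ _ _ _
                  (orientation-bca k i j k<i i<j) (orientation-acb i l j i<l l<j) ij-separates)
                (opposite-involutive _)

  SlopeP : Pt → Pt → Pt → Pt → Set
  SlopeP = SlopeLess n ε x y

  crossSlope : Pt → Pt → Pt → Pt → ℚ
  crossSlope i j k l = (y j Q.- y i) Q.* (x l Q.- x k)

  crossSlope-orientation : ∀ i j k l →
    crossSlope k l i j ≡ crossSlope i j k l Q.+ (orientation i j l Q.- orientation i j k)
  crossSlope-orientation i j k l = det-slope (x i) (y i) (x j) (y j) (x k) (y k) (x l) (y l)

  CwCrossing⇒SlopeLess : ∀ i j k l → i F.< j → k F.< l →
                         CwCrossing (toℕ i) (toℕ j) (toℕ k) (toℕ l) → SlopeP i j k l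
  CwCrossing⇒SlopeLess i j k l i<j k<l c with CwCrossing⇒orientationSigns i j k l i<j k<l c
  ... | ijk⁻ , ijl⁺ , _ = subst (crossSlope i j k l Q.<_) (sym (crossSlope-orientation i j k l))
                           (c<c+d _ _ (HasSign-difference _ _ plus ijk⁻ ijl⁺))

  CwCrossing⇒¬SlopeLess-swap : ∀ i j k l → i F.< j → k F.< l →
                               CwCrossing (toℕ i) (toℕ j) (toℕ k) (toℕ l) → ¬ SlopeP k l i j
  CwCrossing⇒¬SlopeLess-swap i j k l i<j k<l c with CwCrossing⇒orientationSigns i j k l i<j k<l c
  ... | _ , _ , kli⁺ , klj⁻ = QP.<-asym (c+d<c _ _ (HasSign-difference _ _ minus kli⁺ klj⁻))
                               ∘ subst (crossSlope k l i j Q.<_) (crossSlope-orientation k l i j)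

module Caracol (m : ℕ) (ε : Fin (suc m) → Sign) where

  n : ℕ
  n = suc m

  open FramingLatticeDef (caracol n ε) public
  open FramedGraph (caracol n ε) using (src; tgt)
  open PathLemmas (caracol n ε)
  open Crossing m ε

  inRank outRank : CEdge n → ℕ
  inRank  = cinRank n ε
  outRank = coutRank n ε

  sArc<ᵢhor⇔ : ∀ k → inRank (sArc k) N.< inRank (hor k) ⇔ ε k ≡ plus
  sArc<ᵢhor⇔ k with ε k
  ... | plus  = mk⇔ (λ _ → refl) (λ _ → s≤s z≤n)
  ... | minus = mk⇔ (λ ()) (λ ())

  hor<ᵢsArc⇔ : ∀ k → inRank (hor k) N.< inRank (sArc k) ⇔ ε k ≡ minus
  hor<ᵢsArc⇔ k with ε k
  ... | plus  = mk⇔ (λ ()) (λ ())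
  ... | minus = mk⇔ (λ _ → refl) (λ _ → s≤s z≤n)

  tArc<ₒhor⇔ : ∀ k → outRank (tArc k) N.< outRank (hor k) ⇔ ε k ≡ plus
  tArc<ₒhor⇔ k with ε k
  ... | plus  = mk⇔ (λ _ → refl) (λ _ → s≤s z≤n)
  ... | minus = mk⇔ (λ ()) (λ ())

  hor<ₒtArc⇔ : ∀ k → outRank (hor k) N.< outRank (tArc k) ⇔ ε k ≡ minus
  hor<ₒtArc⇔ k with ε k
  ... | plus  = mk⇔ (λ ()) (λ ())
  ... | minus = mk⇔ (λ _ → refl) (λ _ → s≤s z≤n)

  V : ℕ → CVertex n
  V p = v (clamp p)

  s≢V : ∀ p → ¬ s ≡ V p
  s≢V p ()

  position : CVertex n → ℕ
  position s     = 0
  position (v i) = suc (toℕ i)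
  position t     = suc (suc n)

  position-V : ∀ p → p N.≤ n → position (V p) ≡ suc p
  position-V p p≤n = cong suc (toℕ-clamp p p≤n)

  V-injective : ∀ p q → p N.≤ n → q N.≤ n → V p ≡ V q → p ≡ q
  V-injective p q p≤n q≤n Vp≡Vq =
    trans (sym (toℕ-clamp p p≤n)) (trans (cong (pred ∘ position) Vp≡Vq) (toℕ-clamp q q≤n))

  entry : ℕ → CEdge n
  entry zero    = s0
  entry (suc a) = sArc (clamp a)

  exit : ℕ → CEdge n
  exit b with b N.<? n
  ... | yes _ = tArc (clamp b)
  ... | no  _ = nt

  lineFrom : ℕ → ℕ → List (CEdge n)
  lineFrom a zero    = []
  lineFrom a (suc l) = hor (clamp a) ∷ lineFrom (suc a) l

  line : ℕ → ℕ → List (CEdge n)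
  line a b = lineFrom a (b ∸ a)

  route : ℕ → ℕ → Path
  route a b = entry a ∷ (line a b ++ [ exit b ])

  exit-< : ∀ b → b N.< n → exit b ≡ tArc (clamp b)
  exit-< b b<n with b N.<? n
  ... | yes _   = refl
  ... | no  b≮n = ⊥-elim (b≮n b<n)

  exit-n : exit n ≡ nt
  exit-n with n N.<? n
  ... | yes n<n = ⊥-elim (NP.<-irrefl refl n<n)
  ... | no  _   = refl

  lineFrom-+ : ∀ a l₁ l₂ → lineFrom a (l₁ + l₂) ≡ lineFrom a l₁ ++ lineFrom (a + l₁) l₂
  lineFrom-+ a zero     l₂ = cong (λ z → lineFrom z l₂) (sym (NP.+-identityʳ a))
  lineFrom-+ a (suc l₁) l₂ = cong (hor (clamp a) ∷_) (trans (lineFrom-+ (suc a) l₁ l₂)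
                               (cong (λ z → lineFrom (suc a) l₁ ++ lineFrom z l₂) (sym (NP.+-suc a l₁))))

  line-refl : ∀ a → line a a ≡ []
  line-refl a rewrite NP.n∸n≡0 a = refl

  line-cons : ∀ a b → a N.< b → line a b ≡ hor (clamp a) ∷ line (suc a) b
  line-cons a b a<b rewrite NP.+-∸-assoc 1 a<b = refl

  line-++ : ∀ a p b → a N.≤ p → p N.≤ b → line a b ≡ line a p ++ line p b
  line-++ a p b a≤p p≤b = begin
    lineFrom a (b ∸ a)
      ≡⟨ cong (lineFrom a) b∸a≡ ⟩
    lineFrom a ((p ∸ a) + (b ∸ p))
      ≡⟨ lineFrom-+ a (p ∸ a) (b ∸ p) ⟩
    lineFrom a (p ∸ a) ++ lineFrom (a + (p ∸ a)) (b ∸ p)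
      ≡⟨ cong (λ z → lineFrom a (p ∸ a) ++ lineFrom z (b ∸ p)) (NP.m+[n∸m]≡n a≤p) ⟩
    lineFrom a (p ∸ a) ++ lineFrom p (b ∸ p)
      ∎
    where
    open ≡-Reasoning
    b∸a≡ : b ∸ a ≡ (p ∸ a) + (b ∸ p)
    b∸a≡ = trans (cong (_∸ a) (sym (NP.m+[n∸m]≡n p≤b))) (NP.+-∸-comm (b ∸ p) a≤p)

  line-split : ∀ a c p → a N.≤ c → c N.< p → line a p ≡ line a c ++ hor (clamp c) ∷ line (suc c) p
  line-split a c p a≤c c<p = begin
    line a p                                    ≡⟨ line-++ a c p a≤c (NP.<⇒≤ c<p) ⟩
    line a c ++ line c p                        ≡⟨ cong (line a c ++_) (line-cons c p c<p) ⟩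
    line a c ++ hor (clamp c) ∷ line (suc c) p  ∎
    where open ≡-Reasoning

  line-snoc : ∀ a p → a N.≤ p → line a (suc p) ≡ line a p ++ [ hor (clamp p) ]
  line-snoc a p a≤p = trans (line-split a p (suc p) a≤p (NP.n<1+n p))
                            (cong (λ l → line a p ++ hor (clamp p) ∷ l) (line-refl (suc p)))

  line-exit-split : ∀ a c p → a N.≤ c → c N.< p →
    line a p ++ [ exit p ] ≡ line a c ++ hor (clamp c) ∷ (line (suc c) p ++ [ exit p ])
  line-exit-split a c p a≤c c<p = trans (cong (_++ [ exit p ]) (line-split a c p a≤c c<p))
                                        (LP.++-assoc (line a c) (hor (clamp c) ∷ line (suc c) p) [ exit p ])

  ∈-lineFrom⁻ : ∀ a l e → e ∈ lineFrom a l → ∃[ r ] a N.≤ r × r N.< a + l × e ≡ hor (clamp r)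
  ∈-lineFrom⁻ a (suc l) e (here refl) = a , NP.≤-refl , NP.m<m+n a (s≤s z≤n) , refl
  ∈-lineFrom⁻ a (suc l) e (there e∈) with ∈-lineFrom⁻ (suc a) l e e∈
  ... | r , a<r , r< , e≡ = r , NP.<⇒≤ a<r , subst (r N.<_) (sym (NP.+-suc a l)) r< , e≡

  ∈-line⁻ : ∀ a b e → a N.≤ b → e ∈ line a b → ∃[ r ] a N.≤ r × r N.< b × e ≡ hor (clamp r)
  ∈-line⁻ a b e a≤b e∈ with ∈-lineFrom⁻ a (b ∸ a) e e∈
  ... | r , a≤r , r< , e≡ = r , a≤r , subst (r N.<_) (NP.m+[n∸m]≡n a≤b) r< , e≡

  ∈-line⁺ : ∀ a r b → a N.≤ r → r N.< b → hor (clamp r) ∈ line a b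
  ∈-line⁺ a r b a≤r r<b rewrite line-++ a r b a≤r (NP.<⇒≤ r<b) | line-cons r b r<b =
    ∈-++⁺ʳ (line a r) (here refl)

  tgt-entry : ∀ a → tgt (entry a) ≡ V a
  tgt-entry zero    = refl
  tgt-entry (suc a) = refl

  src-entry : ∀ a → src (entry a) ≡ s
  src-entry zero    = refl
  src-entry (suc a) = refl

  src-hor : ∀ r → r N.< n → src (hor (clamp r)) ≡ V r
  src-hor r r<n = cong v (inject₁-clamp r (NP.≤-pred r<n))

  src-exit : ∀ b → b N.≤ n → src (exit b) ≡ V b
  src-exit b b≤n with NP.m≤n⇒m<n∨m≡n b≤n
  ... | inj₁ b<n  rewrite exit-< b b<n = cong v (inject₁-clamp b (NP.≤-pred b<n))
  ... | inj₂ refl rewrite exit-n       = cong v (fromℕ≡clamp n)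

  tgt-exit : ∀ b → tgt (exit b) ≡ t
  tgt-exit b with b N.<? n
  ... | yes _ = refl
  ... | no  _ = refl

  StartsAt-line : ∀ p b → p N.≤ b → b N.≤ n → StartsAt (V p) (line p b ++ [ exit b ])
  StartsAt-line p b p≤b b≤n with NP.m≤n⇒m<n∨m≡n p≤b
  ... | inj₁ p<b  rewrite line-cons p b p<b = src-hor p (NP.<-≤-trans p<b b≤n)
  ... | inj₂ refl rewrite line-refl p       = src-exit p b≤n

  route-upTo : ∀ a p b → a N.≤ p → p N.≤ b → b N.≤ n → route a b upTo V p ≡ entry a ∷ line a p
  route-upTo a p b a≤p p≤b b≤n with NP.m≤n⇒m<n∨m≡n a≤p
  ... | inj₂ refl rewrite dec-true (tgt (entry a) ≟CV V a) (tgt-entry a) = cong (entry a ∷_) (sym (line-refl a))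
  route-upTo a (suc p) b a≤p p<b b≤n | inj₁ a<p
    rewrite dec-false (tgt (entry a) ≟CV V (suc p))
              (λ eq → NP.<⇒≢ a<p (V-injective a (suc p) (NP.≤-trans a≤p (NP.≤-trans p<b b≤n))
                                    (NP.≤-trans p<b b≤n) (trans (sym (tgt-entry a)) eq)))
    = cong (entry a ∷_) (begin
        (line a b ++ [ exit b ]) upTo V (suc p)
          ≡⟨ cong (_upTo V (suc p)) (line-exit-split a p b a≤p′ p<b) ⟩
        (line a p ++ hor (clamp p) ∷ (line (suc p) b ++ [ exit b ])) upTo V (suc p)
          ≡⟨ upTo-++-∷ (line a p) (hor (clamp p)) _ (V (suc p)) not-yet refl ⟩
        line a p ++ [ hor (clamp p) ]
          ≡⟨ sym (line-snoc a p a≤p′) ⟩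
        line a (suc p) ∎)
    where
    open ≡-Reasoning
    a≤p′ : a N.≤ p
    a≤p′ = NP.≤-pred a<p
    p<n : p N.< n
    p<n = NP.≤-trans p<b b≤n
    not-yet : ∀ e → e ∈ line a p → ¬ tgt e ≡ V (suc p)
    not-yet e e∈ tgt≡ with ∈-line⁻ a p e a≤p′ e∈
    ... | r , _ , r<p , refl =
      NP.<⇒≢ (s≤s r<p) (V-injective (suc r) (suc p) (NP.≤-trans r<p (NP.<⇒≤ p<n)) p<n tgt≡)

  route-from : ∀ a p b → a N.≤ p → p N.≤ b → b N.≤ n → route a b from V p ≡ line p b ++ [ exit b ]
  route-from a p b a≤p p≤b b≤n
    rewrite dec-false (src (entry a) ≟CV V p) (λ eq → s≢V p (trans (sym (src-entry a)) eq)) =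
    begin
      (line a b ++ [ exit b ]) from V p
        ≡⟨ cong (λ z → (z ++ [ exit b ]) from V p) (line-++ a p b a≤p p≤b) ⟩
      ((line a p ++ line p b) ++ [ exit b ]) from V p
        ≡⟨ cong (_from V p) (LP.++-assoc (line a p) (line p b) _) ⟩
      (line a p ++ (line p b ++ [ exit b ])) from V p
        ≡⟨ from-++ (line a p) _ (V p) not-yet (StartsAt-line p b p≤b b≤n) ⟩
      line p b ++ [ exit b ] ∎
    where
    open ≡-Reasoning
    not-yet : ∀ e → e ∈ line a p → ¬ src e ≡ V p
    not-yet e e∈ src≡ with ∈-line⁻ a p e a≤p e∈
    ... | r , _ , r<p , refl =
      NP.<-irrefl (V-injective r p (NP.≤-trans (NP.<⇒≤ r<p) (NP.≤-trans p≤b b≤n)) (NP.≤-trans p≤b b≤n)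
                    (trans (sym (src-hor r (NP.<-≤-trans r<p (NP.≤-trans p≤b b≤n)))) src≡)) r<p

  reverse-entry-line-hor : ∀ a c p → a N.≤ c → c N.< p →
    reverse (entry a ∷ line a p) ≡ reverse (line (suc c) p) ++ hor (clamp c) ∷ reverse (entry a ∷ line a c)
  reverse-entry-line-hor a c p a≤c c<p =
    trans (cong (reverse ∘ (entry a ∷_)) (line-split a c p a≤c c<p))
          (reverse-++-∷ (entry a ∷ line a c) (hor (clamp c)) (line (suc c) p))

  reverse-entry-line-sArc : ∀ c p →
    reverse (entry (suc c) ∷ line (suc c) p) ≡ reverse (line (suc c) p) ++ sArc (clamp c) ∷ []
  reverse-entry-line-sArc c p = reverse-++-∷ [] (sArc (clamp c)) (line (suc c) p)

  Lex-in⇒InBefore : ∀ a c p → a N.≤ p → c N.≤ p →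
    Lex inRank (reverse (entry a ∷ line a p)) (reverse (entry c ∷ line c p)) → InBefore a c
  Lex-in⇒InBefore a c p a≤p c≤p lex with N.<-cmp a c
  ... | tri≈ _ refl _ = ⊥-elim (Lex-irrefl inRank _ lex)
  Lex-in⇒InBefore a (suc c) p a≤p c<p lex | tri< a<c _ _ =
    inj₁ (a<c , Equivalence.to (hor<ᵢsArc⇔ (clamp c))
      (Lex-fork⁻ inRank (reverse (line (suc c) p)) _ _ (reverse (entry a ∷ line a c)) [] (λ ())
        (subst₂ (Lex inRank) (reverse-entry-line-hor a c p (NP.≤-pred a<c) c<p) (reverse-entry-line-sArc c p)
          lex)))
  Lex-in⇒InBefore (suc a) c p a<p c≤p lex | tri> _ _ c<a =
    inj₂ (c<a , Equivalence.to (sArc<ᵢhor⇔ (clamp a))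
      (Lex-fork⁻ inRank (reverse (line (suc a) p)) _ _ [] (reverse (entry c ∷ line c a)) (λ ())
        (subst₂ (Lex inRank) (reverse-entry-line-sArc a p) (reverse-entry-line-hor c a p (NP.≤-pred c<a) a<p)
          lex)))

  InBefore⇒Lex-in : ∀ a c p → a N.≤ p → c N.≤ p → InBefore a c →
    Lex inRank (reverse (entry a ∷ line a p)) (reverse (entry c ∷ line c p))
  InBefore⇒Lex-in a (suc c) p a≤p c<p (inj₁ (a<c , c⁻)) =
    subst₂ (Lex inRank) (sym (reverse-entry-line-hor a c p (NP.≤-pred a<c) c<p))
                        (sym (reverse-entry-line-sArc c p))
      (Lex-fork⁺ inRank (reverse (line (suc c) p)) _ _ (reverse (entry a ∷ line a c)) [] (λ ())
        (Equivalence.from (hor<ᵢsArc⇔ (clamp c)) c⁻))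
  InBefore⇒Lex-in (suc a) c p a<p c≤p (inj₂ (c<a , a⁺)) =
    subst₂ (Lex inRank) (sym (reverse-entry-line-sArc a p))
                        (sym (reverse-entry-line-hor c a p (NP.≤-pred c<a) a<p))
      (Lex-fork⁺ inRank (reverse (line (suc a) p)) _ _ [] (reverse (entry c ∷ line c a)) (λ ())
        (Equivalence.from (sArc<ᵢhor⇔ (clamp a)) a⁺))

  line-exit-tArc : ∀ p b → b N.< n → line p b ++ [ exit b ] ≡ line p b ++ tArc (clamp b) ∷ []
  line-exit-tArc p b b<n = cong (λ e → line p b ++ [ e ]) (exit-< b b<n)

  Lex-out⇒OutAfter : ∀ p b d → p N.≤ b → b N.≤ n → p N.≤ d → d N.≤ n →
    Lex outRank (line p d ++ [ exit d ]) (line p b ++ [ exit b ]) → OutAfter (suc b) (suc d)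
  Lex-out⇒OutAfter p b d p≤b b≤n p≤d d≤n lex with N.<-cmp b d
  ... | tri≈ _ refl _ = ⊥-elim (Lex-irrefl outRank _ lex)
  ... | tri< b<d _ _ =
    inj₁ (s≤s b<d , Equivalence.to (hor<ₒtArc⇔ (clamp b))
      (Lex-fork⁻ outRank (line p b) _ _ (line (suc b) d ++ [ exit d ]) [] (λ ())
        (subst₂ (Lex outRank) (line-exit-split p b d p≤b b<d) (line-exit-tArc p b (NP.<-≤-trans b<d d≤n))
          lex)))
  ... | tri> _ _ d<b =
    inj₂ (s≤s d<b , Equivalence.to (tArc<ₒhor⇔ (clamp d))
      (Lex-fork⁻ outRank (line p d) _ _ [] (line (suc d) b ++ [ exit b ]) (λ ())
        (subst₂ (Lex outRank) (line-exit-tArc p d (NP.<-≤-trans d<b b≤n)) (line-exit-split p d b p≤d d<b)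
          lex)))

  OutAfter⇒Lex-out : ∀ p b d → p N.≤ b → b N.≤ n → p N.≤ d → d N.≤ n →
    OutAfter (suc b) (suc d) →
    Lex outRank (line p d ++ [ exit d ]) (line p b ++ [ exit b ])
  OutAfter⇒Lex-out p b d p≤b b≤n p≤d d≤n (inj₁ (s≤s b<d , b⁻)) =
    subst₂ (Lex outRank) (sym (line-exit-split p b d p≤b b<d))
                         (sym (line-exit-tArc p b (NP.<-≤-trans b<d d≤n)))
      (Lex-fork⁺ outRank (line p b) _ _ (line (suc b) d ++ [ exit d ]) [] (λ ())
        (Equivalence.from (hor<ₒtArc⇔ (clamp b)) b⁻))
  OutAfter⇒Lex-out p b d p≤b b≤n p≤d d≤n (inj₂ (s≤s d<b , d⁺)) =
    subst₂ (Lex outRank) (sym (line-exit-tArc p d (NP.<-≤-trans d<b b≤n)))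
                         (sym (line-exit-split p d b p≤d d<b))
      (Lex-fork⁺ outRank (line p d) _ _ [] (line (suc d) b ++ [ exit b ]) (λ ())
        (Equivalence.from (tArc<ₒhor⇔ (clamp d)) d⁺))

  ∈-route⁻ : ∀ a b e → a N.≤ b → e ∈ route a b →
             e ≡ entry a ⊎ (∃[ r ] a N.≤ r × r N.< b × e ≡ hor (clamp r)) ⊎ e ≡ exit b
  ∈-route⁻ a b e a≤b (here refl) = inj₁ refl
  ∈-route⁻ a b e a≤b (there e∈) with ∈-++⁻ (line a b) e∈
  ... | inj₁ e∈line         = inj₂ (inj₁ (∈-line⁻ a b e a≤b e∈line))
  ... | inj₂ (here refl) = inj₂ (inj₂ refl)

  ∈-route⇒a<position-tgt : ∀ a b e → a N.≤ b → b N.≤ n → e ∈ route a b → a N.< position (tgt e)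
  ∈-route⇒a<position-tgt a b e a≤b b≤n e∈ with ∈-route⁻ a b e a≤b e∈
  ... | inj₁ refl rewrite tgt-entry a | position-V a (NP.≤-trans a≤b b≤n) = NP.≤-refl
  ... | inj₂ (inj₁ (r , a≤r , r<b , refl))
    rewrite position-V (suc r) (NP.≤-trans r<b b≤n) = s≤s (NP.m≤n⇒m≤1+n a≤r)
  ... | inj₂ (inj₂ refl) rewrite tgt-exit b = s≤s (NP.m≤n⇒m≤1+n (NP.≤-trans a≤b b≤n))

  ∈-route⇒position-src≤b : ∀ a b e → a N.≤ b → b N.≤ n → e ∈ route a b → position (src e) N.≤ suc b
  ∈-route⇒position-src≤b a b e a≤b b≤n e∈ with ∈-route⁻ a b e a≤b e∈
  ... | inj₁ refl rewrite src-entry a = z≤n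
  ... | inj₂ (inj₁ (r , a≤r , r<b , refl)) =
    subst (N._≤ suc b) (sym (trans (cong position (src-hor r (NP.<-≤-trans r<b b≤n)))
                                   (position-V r (NP.≤-trans (NP.<⇒≤ r<b) b≤n))))
      (s≤s (NP.<⇒≤ r<b))
  ... | inj₂ (inj₂ refl) rewrite src-exit b b≤n | position-V b b≤n = NP.≤-refl

  Inner-route⁻ : ∀ a b w → a N.≤ b → b N.≤ n → Inner w (route a b) → ∃[ p ] w ≡ V p × a N.≤ p × p N.≤ b
  Inner-route⁻ a b w a≤b b≤n ((e , e∈ , tgt≡) , (f , f∈ , src≡))
    with w | ∈-route⇒a<position-tgt a b e a≤b b≤n e∈ | ∈-route⇒position-src≤b a b f a≤b b≤n f∈
  ... | s   | a<0   | _ rewrite tgt≡ with () ← a<0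
  ... | t   | _     | n+1≤b rewrite src≡ = ⊥-elim (NP.<-irrefl refl (NP.≤-trans (NP.≤-pred n+1≤b) b≤n))
  ... | v i | a<i+1 | i+1≤b+1 rewrite tgt≡ | src≡ =
    toℕ i , cong v (sym (clamp-toℕ i)) , NP.≤-pred a<i+1 , NP.≤-pred i+1≤b+1

  route-enters : ∀ a p b → a N.≤ p → p N.≤ b → ∃[ e ] e ∈ route a b × tgt e ≡ V p
  route-enters a p b a≤p p≤b with NP.m≤n⇒m<n∨m≡n a≤p
  ... | inj₂ refl = entry a , here refl , tgt-entry a
  route-enters a (suc q) b a≤p p≤b | inj₁ a<p =
    hor (clamp q) , there (∈-++⁺ˡ (∈-line⁺ a q b (NP.≤-pred a<p) (NP.<-≤-trans (NP.n<1+n q) p≤b))) , refl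

  route-leaves : ∀ a p b → a N.≤ p → p N.≤ b → b N.≤ n → ∃[ f ] f ∈ route a b × src f ≡ V p
  route-leaves a p b a≤p p≤b b≤n with NP.m≤n⇒m<n∨m≡n p≤b
  ... | inj₁ p<b  = hor (clamp p) , there (∈-++⁺ˡ (∈-line⁺ a p b a≤p p<b)) , src-hor p (NP.<-≤-trans p<b b≤n)
  ... | inj₂ refl = exit p , there (∈-++⁺ʳ (line a p) (here refl)) , src-exit p b≤n

  Inner-route⁺ : ∀ a p b → a N.≤ p → p N.≤ b → b N.≤ n → Inner (V p) (route a b)
  Inner-route⁺ a p b a≤p p≤b b≤n = route-enters a p b a≤p p≤b , route-leaves a p b a≤p p≤b b≤n

  cw⇒CwCrossing : ∀ a b c d w → a N.≤ b → b N.≤ n → c N.≤ d → d N.≤ n →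
                  route a b <cw[ w ] route c d → CwCrossing a (suc b) c (suc d)
  cw⇒CwCrossing a b c d w a≤b b≤n c≤d d≤n (inner-ab , inner-cd , in< , out<)
    with Inner-route⁻ a b w a≤b b≤n inner-ab
  ... | p , refl , a≤p , p≤b with Inner-route⁻ c d (V p) c≤d d≤n inner-cd
  ... | q , Vp≡Vq , c≤q , q≤d with V-injective p q (NP.≤-trans p≤b b≤n) (NP.≤-trans q≤d d≤n) Vp≡Vq
  ... | refl =
    s≤s (NP.≤-trans a≤p q≤d) , s≤s (NP.≤-trans c≤q p≤b) ,
    Lex-in⇒InBefore a c p a≤p c≤q
      (subst₂ (Lex inRank) (cong reverse (route-upTo a p b a≤p p≤b b≤n))
                           (cong reverse (route-upTo c p d c≤q q≤d d≤n)) in<) ,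
    Lex-out⇒OutAfter p b d p≤b b≤n q≤d d≤n
      (subst₂ (Lex outRank) (route-from c p d c≤q q≤d d≤n) (route-from a p b a≤p p≤b b≤n) out<)

  CwCrossing⇒cw : ∀ a b c d → a N.≤ b → b N.≤ n → c N.≤ d → d N.≤ n →
                  CwCrossing a (suc b) c (suc d) → ∃[ w ] route a b <cw[ w ] route c d
  CwCrossing⇒cw a b c d a≤b b≤n c≤d d≤n (s≤s a≤d , s≤s c≤b , in< , out<) =
    V p , Inner-route⁺ a p b a≤p p≤b b≤n , Inner-route⁺ c p d c≤p p≤d d≤n ,
    subst₂ (Lex inRank) (sym (cong reverse (route-upTo a p b a≤p p≤b b≤n)))
                        (sym (cong reverse (route-upTo c p d c≤p p≤d d≤n)))
      (InBefore⇒Lex-in a c p a≤p c≤p in<) ,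
    subst₂ (Lex outRank) (sym (route-from c p d c≤p p≤d d≤n)) (sym (route-from a p b a≤p p≤b b≤n))
      (OutAfter⇒Lex-out p b d p≤b b≤n p≤d d≤n out<)
    where
    p : ℕ
    p = a N.⊔ c
    a≤p : a N.≤ p
    a≤p = NP.m≤m⊔n a c
    c≤p : c N.≤ p
    c≤p = NP.m≤n⊔m a c
    p≤b : p N.≤ b
    p≤b = NP.⊔-lub a≤b c≤b
    p≤d : p N.≤ d
    p≤d = NP.⊔-lub a≤d c≤d

  Connected-line : ∀ l p b → b ∸ p ≡ l → p N.≤ b → b N.≤ n → Connected (line p b ++ [ exit b ])
  Connected-line zero p b b∸p≡0 p≤b b≤n with NP.≤-antisym p≤b (NP.m∸n≡0⇒m≤n b∸p≡0)
  ... | refl rewrite line-refl p = tt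
  Connected-line (suc l) p b b∸p≡ p≤b b≤n with NP.m≤n⇒m<n∨m≡n p≤b
  ... | inj₂ refl rewrite NP.n∸n≡0 p with () ← b∸p≡
  ... | inj₁ p<b rewrite line-cons p b p<b =
    Connected-∷ (hor (clamp p)) (line (suc p) b ++ [ exit b ]) (StartsAt-line (suc p) b p<b b≤n)
      (Connected-line l (suc p) b (trans (sym (NP.pred[m∸n]≡m∸[1+n] b p)) (cong pred b∸p≡)) p<b b≤n)

  route-isRoute : ∀ a b → a N.≤ b → b N.≤ n → IsRoute (route a b)
  route-isRoute a b a≤b b≤n =
    src-entry a ,
    EndsAt-∷ʳ (entry a ∷ line a b) (exit b) t (tgt-exit b) ,
    Connected-∷ (entry a) (line a b ++ [ exit b ])
      (subst (λ w → StartsAt w (line a b ++ [ exit b ])) (sym (tgt-entry a)) (StartsAt-line a b a≤b b≤n))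
      (Connected-line (b ∸ a) a b refl a≤b b≤n)

  src≢t : ∀ e → ¬ src e ≡ t
  src≢t s0       ()
  src≢t (hor _)  ()
  src≢t nt       ()
  src≢t (sArc _) ()
  src≢t (tArc _) ()

  toℕ-inject₁-V : ∀ (k : Fin n) p → p N.≤ n → v (inject₁ k) ≡ V p → toℕ k ≡ p
  toℕ-inject₁-V k p p≤n eq =
    trans (sym (FP.toℕ-inject₁ k)) (trans (cong (pred ∘ position) eq) (toℕ-clamp p p≤n))

  clamp-inject₁-V : ∀ (k : Fin n) p → p N.≤ n → v (inject₁ k) ≡ V p → k ≡ clamp p
  clamp-inject₁-V k p p≤n eq = trans (sym (clamp-toℕ k)) (cong clamp (toℕ-inject₁-V k p p≤n eq))

  IsRoute-tail : ∀ P p → p N.≤ n → StartsAt (V p) P → Connected P → EndsAt t P →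
                 ∃[ b ] p N.≤ b × b N.≤ n × P ≡ line p b ++ [ exit b ]
  IsRoute-tail (s0 ∷ P)     p p≤n () _ _
  IsRoute-tail (sArc _ ∷ P) p p≤n () _ _
  IsRoute-tail (hor k ∷ []) p p≤n _ _ ()
  IsRoute-tail (hor k ∷ f ∷ P) p p≤n st (tgt≡src , c) et
    with IsRoute-tail (f ∷ P) (suc p) (subst (N._< n) (toℕ-inject₁-V k p p≤n st) (FP.toℕ<n k))
           (trans (sym tgt≡src) (cong (v ∘ F.suc) (clamp-inject₁-V k p p≤n st))) c et
  ... | b , p<b , b≤n , eq =
    b , NP.<⇒≤ p<b , b≤n ,
    trans (cong₂ _∷_ (cong hor (clamp-inject₁-V k p p≤n st)) eq)
          (sym (cong (_++ [ exit b ]) (line-cons p b p<b)))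
  IsRoute-tail (tArc k ∷ f ∷ P) p p≤n st (tgt≡src , _) _ = ⊥-elim (src≢t f (sym tgt≡src))
  IsRoute-tail (tArc k ∷ []) p p≤n st _ _ with toℕ-inject₁-V k p p≤n st
  ... | refl =
    toℕ k , NP.≤-refl , p≤n ,
    trans (cong (λ z → tArc z ∷ []) (sym (clamp-toℕ k)))
      (trans (cong [_] (sym (exit-< (toℕ k) (FP.toℕ<n k))))
             (cong (_++ [ exit (toℕ k) ]) (sym (line-refl (toℕ k)))))
  IsRoute-tail (nt ∷ f ∷ P) p p≤n st (tgt≡src , _) _ = ⊥-elim (src≢t f (sym tgt≡src))
  IsRoute-tail (nt ∷ []) p p≤n st _ _
    with trans (sym (FP.toℕ-fromℕ n)) (trans (cong (pred ∘ position) st) (toℕ-clamp p p≤n))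
  ... | refl =
    n , NP.≤-refl , NP.≤-refl , trans (cong [_] (sym exit-n)) (cong (_++ [ exit n ]) (sym (line-refl n)))

  IsRoute⇒route : ∀ P → IsRoute P → ∃[ a ] ∃[ b ] a N.≤ b × b N.≤ n × P ≡ route a b
  IsRoute⇒route (s0 ∷ [])    (_ , () , _)
  IsRoute⇒route (s0 ∷ f ∷ P) (_ , et , (tgt≡src , c)) with IsRoute-tail (f ∷ P) 0 z≤n (sym tgt≡src) c et
  ... | b , 0≤b , b≤n , eq = 0 , b , 0≤b , b≤n , cong (s0 ∷_) eq
  IsRoute⇒route (sArc k ∷ [])    (_ , () , _)
  IsRoute⇒route (sArc k ∷ f ∷ P) (_ , et , (tgt≡src , c))
    with IsRoute-tail (f ∷ P) (suc (toℕ k)) (FP.toℕ<n k)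
           (trans (sym tgt≡src) (cong (v ∘ F.suc) (sym (clamp-toℕ k)))) c et
  ... | b , a≤b , b≤n , eq = suc (toℕ k) , b , a≤b , b≤n , cong₂ _∷_ (cong sArc (sym (clamp-toℕ k))) eq
  IsRoute⇒route (hor _ ∷ _)  (() , _)
  IsRoute⇒route (nt ∷ _)     (() , _)
  IsRoute⇒route (tArc _ ∷ _) (() , _)

  startOf : Path → ℕ
  startOf []      = 0
  startOf (e ∷ _) = pred (position (tgt e))

  endOf : Path → ℕ
  endOf []          = 0
  endOf (e ∷ [])    = pred (position (src e))
  endOf (_ ∷ f ∷ P) = endOf (f ∷ P)

  endOf-∷ʳ : ∀ P e → endOf (P ++ [ e ]) ≡ pred (position (src e))
  endOf-∷ʳ []          e = refl
  endOf-∷ʳ (_ ∷ [])    e = refl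
  endOf-∷ʳ (_ ∷ f ∷ P) e = endOf-∷ʳ (f ∷ P) e

  startOf-route : ∀ a b → a N.≤ n → startOf (route a b) ≡ a
  startOf-route a b a≤n = trans (cong (pred ∘ position) (tgt-entry a)) (cong pred (position-V a a≤n))

  endOf-route : ∀ a b → b N.≤ n → endOf (route a b) ≡ b
  endOf-route a b b≤n = trans (endOf-∷ʳ (entry a ∷ line a b) (exit b))
    (trans (cong (pred ∘ position) (src-exit b b≤n)) (cong pred (position-V b b≤n)))

module Isomorphism (m : ℕ) (ε : Fin (suc m) → Sign) (x y : Fin (2 + suc m) → ℚ)
                   (polygon : IsCambrianPolygon (suc m) ε x y) where

  open Caracol m ε
  open Polygon m ε x y polygon hiding (n)
  open Crossing m ε

  -- The diagonal [p_i, p_j] corresponds to the route entering at i and leaving at j - 1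
  -- (junk for j = 0, which never occurs since i < j).
  segmentRoute : Pt → Pt → Path
  segmentRoute i F.zero    = []
  segmentRoute i (F.suc j) = route (toℕ i) (toℕ j)

  startPt endPt : Path → Pt
  startPt P = clamp (startOf P)
  endPt   P = F.suc (clamp (endOf P))

  segmentRoute-isRoute : ∀ {i j} → i F.< j → IsRoute (segmentRoute i j)
  segmentRoute-isRoute {i} {F.suc j} i<j = route-isRoute (toℕ i) (toℕ j) (NP.≤-pred i<j) (FP.toℕ≤pred[n] j)

  startPt-segmentRoute : ∀ {i j} → i F.< j → startPt (segmentRoute i j) ≡ i
  startPt-segmentRoute {i} {F.suc j} i<j =
    trans (cong clamp (startOf-route (toℕ i) (toℕ j) (NP.≤-trans (NP.≤-pred i<j) (FP.toℕ≤pred[n] j))))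
          (clamp-toℕ i)

  endPt-segmentRoute : ∀ {i j} → i F.< j → endPt (segmentRoute i j) ≡ j
  endPt-segmentRoute {i} {F.suc j} i<j =
    cong F.suc (trans (cong clamp (endOf-route (toℕ i) (toℕ j) (FP.toℕ≤pred[n] j))) (clamp-toℕ j))

  segmentRoute-injective : ∀ {i j k l} → i F.< j → k F.< l →
                           segmentRoute i j ≡ segmentRoute k l → i ≡ k × j ≡ l
  segmentRoute-injective i<j k<l eq =
    trans (sym (startPt-segmentRoute i<j)) (trans (cong startPt eq) (startPt-segmentRoute k<l)) ,
    trans (sym (endPt-segmentRoute i<j)) (trans (cong endPt eq) (endPt-segmentRoute k<l))

  IsSegmentRoute : Path → Set
  IsSegmentRoute P = startPt P F.< endPt P × P ≡ segmentRoute (startPt P) (endPt P)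

  IsRoute⇒segmentRoute : ∀ P → IsRoute P → IsSegmentRoute P
  IsRoute⇒segmentRoute P P-route with IsRoute⇒route P P-route
  ... | a , b , a≤b , b≤n , refl =
    subst₂ N._<_ (sym toℕ-start) (cong suc (sym toℕ-end)) (s≤s a≤b) ,
    cong₂ route (sym toℕ-start) (sym toℕ-end)
    where
    toℕ-start : toℕ (startPt (route a b)) ≡ a
    toℕ-start = trans (cong (toℕ ∘ clamp) (startOf-route a b (NP.≤-trans a≤b b≤n)))
                      (toℕ-clamp a (NP.≤-trans a≤b (NP.m≤n⇒m≤1+n b≤n)))
    toℕ-end : toℕ (clamp {n} (endOf (route a b))) ≡ b
    toℕ-end = trans (cong (toℕ ∘ clamp) (endOf-route a b b≤n)) (toℕ-clamp b b≤n)

  segmentCw⇒CwCrossing : ∀ i j k l w → i F.< j → k F.< l →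
    segmentRoute i j <cw[ w ] segmentRoute k l → CwCrossing (toℕ i) (toℕ j) (toℕ k) (toℕ l)
  segmentCw⇒CwCrossing i (F.suc j) k (F.suc l) w i<j k<l =
    cw⇒CwCrossing (toℕ i) (toℕ j) (toℕ k) (toℕ l) w
      (NP.≤-pred i<j) (FP.toℕ≤pred[n] j) (NP.≤-pred k<l) (FP.toℕ≤pred[n] l)

  CwCrossing⇒segmentCw : ∀ i j k l → i F.< j → k F.< l →
    CwCrossing (toℕ i) (toℕ j) (toℕ k) (toℕ l) → ∃[ w ] segmentRoute i j <cw[ w ] segmentRoute k l
  CwCrossing⇒segmentCw i (F.suc j) k (F.suc l) i<j k<l =
    CwCrossing⇒cw (toℕ i) (toℕ j) (toℕ k) (toℕ l)
      (NP.≤-pred i<j) (FP.toℕ≤pred[n] j) (NP.≤-pred k<l) (FP.toℕ≤pred[n] l)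

  Coherent⇒¬Cross : ∀ i j k l → i F.< j → k F.< l →
                    Coherent (segmentRoute i j) (segmentRoute k l) → ¬ CrossP i j k l
  Coherent⇒¬Cross i j k l i<j k<l coherent cross with Cross⇒CwCrossing i j k l i<j k<l cross
  ... | inj₁ ij↰kl with CwCrossing⇒segmentCw i j k l i<j k<l ij↰kl
  ...   | w , cw@(inner-ij , inner-kl , _) = coherent w inner-ij inner-kl (inj₁ cw)
  Coherent⇒¬Cross i j k l i<j k<l coherent cross | inj₂ kl↰ij with CwCrossing⇒segmentCw k l i j k<l i<j kl↰ij
  ...   | w , cw@(inner-kl , inner-ij , _) = coherent w inner-ij inner-kl (inj₂ cw)

  ¬Cross⇒Coherent : ∀ i j k l → i F.< j → k F.< l →
                    ¬ CrossP i j k l → Coherent (segmentRoute i j) (segmentRoute k l)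
  ¬Cross⇒Coherent i j k l i<j k<l ¬cross w _ _ (inj₁ cw) =
    ¬cross (CwCrossing⇒Cross i j k l i<j k<l (segmentCw⇒CwCrossing i j k l w i<j k<l cw))
  ¬Cross⇒Coherent i j k l i<j k<l ¬cross w _ _ (inj₂ cw) =
    ¬cross (Cross-sym k l i j (CwCrossing⇒Cross k l i j k<l i<j (segmentCw⇒CwCrossing k l i j w k<l i<j cw)))

  Tri : Set₁
  Tri = Triangulation n ε x y

  cliqueSegments : RouteSet → SegSet n ε x y
  cliqueSegments C i j = i F.< j × C (segmentRoute i j)

  segmentRoutes : SegSet n ε x y → RouteSet
  segmentRoutes T P = IsRoute P × T (startPt P) (endPt P)

  route⇒cliqueSegment : ∀ {C : RouteSet} P → IsRoute P → C P → cliqueSegments C (startPt P) (endPt P)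
  route⇒cliqueSegment {C} P P-route P∈C = proj₁ P-segment , subst C (proj₂ P-segment) P∈C
    where
    P-segment : IsSegmentRoute P
    P-segment = IsRoute⇒segmentRoute P P-route

  segment⇒segmentRoute : ∀ {T : SegSet n ε x y} {i j} → i F.< j → T i j → segmentRoutes T (segmentRoute i j)
  segment⇒segmentRoute {T} i<j ij∈T =
    segmentRoute-isRoute i<j , subst₂ T (sym (startPt-segmentRoute i<j)) (sym (endPt-segmentRoute i<j)) ij∈T

  cliqueSegments-isTriangulation : (C : MaxClique) → IsTriangulation n ε x y (cliqueSegments (proj₁ C))
  cliqueSegments-isTriangulation (C , (C-routes , C-coherent) , C-maximal) =
    (λ _ _ → proj₁) , noncrossing , maximal
    where
    noncrossing : ∀ i j k l → cliqueSegments C i j → cliqueSegments C k l → ¬ CrossP i j k l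
    noncrossing i j k l (i<j , ij∈C) (k<l , kl∈C) = Coherent⇒¬Cross i j k l i<j k<l (C-coherent _ _ ij∈C kl∈C)
    maximal : ∀ i j → i F.< j → (∀ k l → cliqueSegments C k l → ¬ CrossP i j k l) → cliqueSegments C i j
    maximal i j i<j ¬cross = i<j , C-maximal (segmentRoute i j) (segmentRoute-isRoute i<j) λ P P∈C →
      let P-route = C-routes P P∈C
          P-segment = IsRoute⇒segmentRoute P P-route
      in subst (Coherent (segmentRoute i j)) (sym (proj₂ P-segment))
           (¬Cross⇒Coherent i j _ _ i<j (proj₁ P-segment)
             (¬cross _ _ (route⇒cliqueSegment {C} P P-route P∈C)))

  segmentRoutes-isMaximalClique : (T : Tri) → IsMaximalClique (segmentRoutes (proj₁ T))
  segmentRoutes-isMaximalClique (T , T-ordered , T-noncrossing , T-maximal) = ((λ _ → proj₁) , coherent) , maximal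
    where
    coherent : ∀ P Q → segmentRoutes T P → segmentRoutes T Q → Coherent P Q
    coherent P Q (P-route , P∈T) (Q-route , Q∈T) =
      subst₂ Coherent (sym (proj₂ P-segment)) (sym (proj₂ Q-segment))
        (¬Cross⇒Coherent _ _ _ _ (proj₁ P-segment) (proj₁ Q-segment) (T-noncrossing _ _ _ _ P∈T Q∈T))
      where
      P-segment : IsSegmentRoute P
      P-segment = IsRoute⇒segmentRoute P P-route
      Q-segment : IsSegmentRoute Q
      Q-segment = IsRoute⇒segmentRoute Q Q-route
    maximal : ∀ R → IsRoute R → (∀ P → segmentRoutes T P → Coherent R P) → segmentRoutes T R
    maximal R R-route R-coherent = R-route , T-maximal _ _ (proj₁ R-segment) λ k l kl∈T →
      let k<l = T-ordered k l kl∈T in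
      Coherent⇒¬Cross _ _ k l (proj₁ R-segment) k<l
        (subst (λ Z → Coherent Z (segmentRoute k l)) (proj₂ R-segment)
          (R-coherent _ (segment⇒segmentRoute {T} k<l kl∈T)))
      where
      R-segment : IsSegmentRoute R
      R-segment = IsRoute⇒segmentRoute R R-route

  toTriangulation : MaxClique → Tri
  toTriangulation C = cliqueSegments (proj₁ C) , cliqueSegments-isTriangulation C

  toClique : Tri → MaxClique
  toClique T = segmentRoutes (proj₁ T) , segmentRoutes-isMaximalClique T

  _≐t_ : Rel Tri 0ℓ
  _≐t_ = _≐T_ n ε x y

  _⋖t_ : Rel Tri 0ℓ
  _⋖t_ = _⋖T_ n ε x y

  ≐-isEquivalence : IsEquivalence _≐_
  ≐-isEquivalence = record
    { refl  = λ P → id , id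
    ; sym   = λ C≐D P → proj₂ (C≐D P) , proj₁ (C≐D P)
    ; trans = λ C≐D D≐E P → proj₁ (D≐E P) ∘ proj₁ (C≐D P) , proj₂ (C≐D P) ∘ proj₂ (D≐E P) }

  ≐t-isEquivalence : IsEquivalence _≐t_
  ≐t-isEquivalence = record
    { refl  = λ i j → id , id
    ; sym   = λ T≐U i j → proj₂ (T≐U i j) , proj₁ (T≐U i j)
    ; trans = λ T≐U U≐V i j → proj₁ (U≐V i j) ∘ proj₁ (T≐U i j) , proj₂ (T≐U i j) ∘ proj₂ (U≐V i j) }

  ⋖-respˡ-≐ : _⋖_ Respectsˡ _≐_
  ⋖-respˡ-≐ C≐C′ (R , R′ , u , R∈C , R<R′ , D≡) =
    R , R′ , u , proj₁ (C≐C′ R) R∈C , R<R′ , λ X →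
    mk⇔ (Sum.map₁ (Product.map₁ (proj₁ (C≐C′ X))) ∘ Equivalence.to (D≡ X))
        (Equivalence.from (D≡ X) ∘ Sum.map₁ (Product.map₁ (proj₂ (C≐C′ X))))

  toTriangulation-cong : toTriangulation Preserves _≐_ ⟶ _≐t_
  toTriangulation-cong C≐D i j =
    Product.map₂ (proj₁ (C≐D (segmentRoute i j))) , Product.map₂ (proj₂ (C≐D (segmentRoute i j)))

  toClique-cong : toClique Preserves _≐t_ ⟶ _≐_
  toClique-cong T≐U P =
    Product.map₂ (proj₁ (T≐U (startPt P) (endPt P))) , Product.map₂ (proj₂ (T≐U (startPt P) (endPt P)))

  toClique∘toTriangulation : ∀ C → C ≐ toClique (toTriangulation C)
  toClique∘toTriangulation (C , (C-routes , _) , _) X =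
    (λ X∈C → C-routes X X∈C , route⇒cliqueSegment {C} X (C-routes X X∈C) X∈C) ,
    (λ (X-route , _ , X∈C) → subst C (sym (proj₂ (IsRoute⇒segmentRoute X X-route))) X∈C)

  toTriangulation∘toClique : ∀ T → toTriangulation (toClique T) ≐t T
  toTriangulation∘toClique (T , T-ordered , _) i j =
    (λ (i<j , _ , ij∈T) → subst₂ T (startPt-segmentRoute i<j) (endPt-segmentRoute i<j) ij∈T) ,
    (λ ij∈T → let i<j = T-ordered i j ij∈T in i<j , segment⇒segmentRoute {T} i<j ij∈T)

  toTriangulation-step : toTriangulation Preserves _⋖_ ⟶ _⋖t_
  toTriangulation-step {C , (C-routes , _) , _} {C′ , (C′-routes , _) , _}
                       (R , R′ , u , R∈C , R<R′ , C′≡) =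
    startPt R , endPt R , startPt R′ , endPt R′ ,
    route⇒cliqueSegment {C} R (C-routes R R∈C) R∈C , proj₁ R′-segment , steeper ,
    λ i j → mk⇔ (forth i j) (back i j)
    where
    R-segment : IsSegmentRoute R
    R-segment = IsRoute⇒segmentRoute R (C-routes R R∈C)
    R′-segment : IsSegmentRoute R′
    R′-segment = IsRoute⇒segmentRoute R′ (C′-routes R′ (Equivalence.from (C′≡ R′) (inj₂ refl)))
    steeper : SlopeP (startPt R) (endPt R) (startPt R′) (endPt R′)
    steeper = CwCrossing⇒SlopeLess _ _ _ _ (proj₁ R-segment) (proj₁ R′-segment)
      (segmentCw⇒CwCrossing _ _ _ _ u (proj₁ R-segment) (proj₁ R′-segment)
        (subst₂ (λ P Q → P <cw[ u ] Q) (proj₂ R-segment) (proj₂ R′-segment) R<R′))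
    forth : ∀ i j → cliqueSegments C′ i j →
            (cliqueSegments C i j × ¬ (i ≡ startPt R × j ≡ endPt R)) ⊎ (i ≡ startPt R′ × j ≡ endPt R′)
    forth i j (i<j , ij∈C′) with Equivalence.to (C′≡ (segmentRoute i j)) ij∈C′
    ... | inj₁ (ij∈C , ij≢R) =
      inj₁ ((i<j , ij∈C) , λ (i≡ , j≡) → ij≢R (trans (cong₂ segmentRoute i≡ j≡) (sym (proj₂ R-segment))))
    ... | inj₂ ij≡R′ = inj₂ (segmentRoute-injective i<j (proj₁ R′-segment) (trans ij≡R′ (proj₂ R′-segment)))
    back : ∀ i j → (cliqueSegments C i j × ¬ (i ≡ startPt R × j ≡ endPt R)) ⊎ (i ≡ startPt R′ × j ≡ endPt R′) →
           cliqueSegments C′ i j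
    back i j (inj₁ ((i<j , ij∈C) , ij≢R)) = i<j , Equivalence.from (C′≡ _)
      (inj₁ (ij∈C , λ ij≡R →
        ij≢R (segmentRoute-injective i<j (proj₁ R-segment) (trans ij≡R (proj₂ R-segment)))))
    back i j (inj₂ (refl , refl)) = proj₁ R′-segment , Equivalence.from (C′≡ _) (inj₂ (sym (proj₂ R′-segment)))

  Exchange : SegSet n ε x y → SegSet n ε x y → Pt → Pt → Pt → Pt → Set
  Exchange T T′ i j k l = ∀ a b → T′ a b ⇔ ((T a b × ¬ (a ≡ i × b ≡ j)) ⊎ (a ≡ k × b ≡ l))

  flip⇒CwCrossing : ∀ (T T′ : Tri) i j k l → proj₁ T i j → k F.< l → SlopeP i j k l →
                    Exchange (proj₁ T) (proj₁ T′) i j k l → CwCrossing (toℕ i) (toℕ j) (toℕ k) (toℕ l)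
  flip⇒CwCrossing (T , T-ordered , T-noncrossing , _) (T′ , _ , _ , T′-maximal)
                  i j k l ij∈T k<l steeper T′≡ =
    [ id , (λ kl↰ij → ⊥-elim (CwCrossing⇒¬SlopeLess-swap k l i j k<l i<j kl↰ij steeper)) ]′
    (Cross⇒CwCrossing i j k l i<j k<l crossing)
    where
    i<j : i F.< j
    i<j = T-ordered i j ij∈T
    -- Otherwise the maximality of T′ would put [i,j] back into T′.
    crossing : CrossP i j k l
    crossing = decidable-stable (Cross? i j k l) λ ¬cross →
      [ (λ (_ , ij≢ij) → ij≢ij (refl , refl)) ,
        (λ (i≡k , j≡l) → QP.<-irrefl refl (subst₂ (SlopeP i j) (sym i≡k) (sym j≡l) steeper)) ]′
      (Equivalence.to (T′≡ i j) (T′-maximal i j i<j λ a b ab∈T′ →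
        [ (λ (ab∈T , _) → T-noncrossing i j a b ij∈T ab∈T) ,
          (λ (a≡k , b≡l) → subst₂ (λ A B → ¬ CrossP i j A B) (sym a≡k) (sym b≡l) ¬cross) ]′
        (Equivalence.to (T′≡ a b) ab∈T′)))

  toClique-step : toClique Preserves _⋖t_ ⟶ _⋖_
  toClique-step {T@(T₀ , T-ordered , _)} {T′@(T′₀ , _)} (i , j , k , l , ij∈T , k<l , steeper , T′≡) =
    segmentRoute i j , segmentRoute k l , proj₁ cw , segment⇒segmentRoute {T₀} i<j ij∈T , proj₂ cw ,
    λ X → mk⇔ (forth X) (back X)
    where
    i<j : i F.< j
    i<j = T-ordered i j ij∈T
    cw : ∃[ w ] segmentRoute i j <cw[ w ] segmentRoute k l
    cw = CwCrossing⇒segmentCw i j k l i<j k<l (flip⇒CwCrossing T T′ i j k l ij∈T k<l steeper T′≡)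
    forth : ∀ X → segmentRoutes T′₀ X → (segmentRoutes T₀ X × ¬ X ≡ segmentRoute i j) ⊎ X ≡ segmentRoute k l
    forth X (X-route , X∈T′) with Equivalence.to (T′≡ (startPt X) (endPt X)) X∈T′
    ... | inj₁ (X∈T , X≢ij) = inj₁ ((X-route , X∈T) , λ X≡ij →
      X≢ij (trans (cong startPt X≡ij) (startPt-segmentRoute i<j) ,
            trans (cong endPt X≡ij) (endPt-segmentRoute i<j)))
    ... | inj₂ (≡k , ≡l) = inj₂ (trans (proj₂ (IsRoute⇒segmentRoute X X-route)) (cong₂ segmentRoute ≡k ≡l))
    back : ∀ X → (segmentRoutes T₀ X × ¬ X ≡ segmentRoute i j) ⊎ X ≡ segmentRoute k l → segmentRoutes T′₀ X
    back X (inj₁ ((X-route , X∈T) , X≢ij)) = X-route , Equivalence.from (T′≡ _ _) (inj₁ (X∈T , λ (≡i , ≡j) →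
      X≢ij (trans (proj₂ (IsRoute⇒segmentRoute X X-route)) (cong₂ segmentRoute ≡i ≡j))))
    back X (inj₂ refl) = segmentRoute-isRoute k<l ,
      Equivalence.from (T′≡ _ _) (inj₂ (startPt-segmentRoute k<l , endPt-segmentRoute k<l))

  isomorphism : OrderIsomorphic (framingLatticeOf (caracol n ε)) (cambrianLattice n ε x y)
  isomorphism = toTriangulation ,
    inverse⇒isOrderIsomorphism ≐-isEquivalence ≐t-isEquivalence (λ {D C C′} → ⋖-respˡ-≐ {D} {C} {C′})
      toTriangulation toClique
      (λ {C D} → toTriangulation-cong {C} {D}) (λ {T U} → toClique-cong {T} {U})
      (λ {C D} → toTriangulation-step {C} {D}) (λ {T U} → toClique-step {T} {U})
      toClique∘toTriangulation toTriangulation∘toClique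

theorem8p1 : (n : ℕ) → 1 ≤ n → (ε : Fin n → Sign) → (x y : Fin (2 + n) → ℚ) →
    IsCambrianPolygon n ε x y →
    OrderIsomorphic (framingLatticeOf (caracol n ε)) (cambrianLattice n ε x y)
theorem8p1 (suc m) (s≤s z≤n) ε x y polygon = Isomorphism.isomorphism m ε x y polygon
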